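{- Let $q$ be a prime power and let $\ell, m$ be positive integers with $\ell \leq m < q$. Let $(\bm{A}, \bm{B}, \bm{C}, \pi)$ be the output of $\mathsf{GenIPKP}^\star(q,\ell,m,1)$, i.e.\ $\bm{A}$ is uniformly random in $\mathbb{F}_q^{\ell \times m, \ell}$, $\bm{B}$ is uniformly random in $\mathbb{F}_q^{\star m \times 1, 1}$, $\pi$ is uniformly random in $\mathbb{S}_m$ (all independent), and $\bm{C} = \bm{A}\bm{\pi}\bm{B}$. Then \[ \mathbb{E}\big[N_{\mathsf{sol}}(\bm{A}, \bm{B}, \bm{C})\big] = 1 + \frac{(m! - 1)(q^{m - \ell} - 1)}{q^m - 1}. \]
   Context: $\mathbb{F}_q$ is the finite field with $q$ elements. $\mathbb{F}_q^{a \times b, r}$ denotes the set of $a\times b$ matrices over $\mathbb{F}_q$ of rank exactly $r$, and $\mathbb{F}_q^{\star a \times b, r}$ the subset of those whose $a$ rows are nonzero and pairwise distinct (so $\mathbb{F}_q^{\star m\times 1,1}$ is the set of column vectors of length $m$ with pairwise distinct nonzero entries). $\mathbb{S}_m$ is the symmetric group on $\{1,\dots,m\}$; for $\pi\in\mathbb{S}_m$, $\bm{\pi}$ is the $m\times m$ permutation matrix with $(i,j)$ entry $\delta_{\pi(i),j}$. $N_{\mathsf{sol}}(\bm{A},\bm{B},\bm{C})$ is the number of $\rho\in\mathbb{S}_m$ with $\bm{A}\bm{\rho}\bm{B}=\bm{C}$. -}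

module Defs where

open import Data.Nat as ℕ using (ℕ; zero; suc)
open import Data.Fin using (Fin; zero; suc)
open import Data.Fin.Properties using (_≟_)
open import Data.Bool using (Bool; true; false; _∧_; not; if_then_else_)
open import Data.List using (List; []; _∷_; _++_; map; concatMap; allFin; filterᵇ; length)
import Data.List as L
open import Data.Product using (Σ; ∃; _×_; _,_)
open import Data.Integer as ℤ using (ℤ)
open import Data.Rational using (ℚ; _/_; 0ℚ)
open import Relation.Binary.PropositionalEquality using (_≡_; _≢_)
open import Relation.Nullary.Decidable using (⌊_⌋)
open import Algebra.Structures using (IsCommutativeRing)

allᵇ : ∀ {A : Set} → (A → Bool) → List A → Bool
allᵇ p []       = true
allᵇ p (x ∷ xs) = p x ∧ allᵇ p xs

sumℕ : List ℕ → ℕ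
sumℕ []       = 0
sumℕ (x ∷ xs) = x ℕ.+ sumℕ xs

-- A finite field with q elements, with carrier Fin q.
-- (Every finite field of order q is isomorphic to one of these.)

record FiniteField (q : ℕ) : Set where
  field
    _+_ _*_   : Fin q → Fin q → Fin q
    -_        : Fin q → Fin q
    0# 1#     : Fin q
    isCommutativeRing : IsCommutativeRing _≡_ _+_ _*_ -_ 0# 1#
    0≢1       : 0# ≢ 1#
    inverse   : ∀ x → x ≢ 0# → ∃ λ y → x * y ≡ 1#

module _ {q : ℕ} (F : FiniteField q) where
  open FiniteField F

  ∑ : (n : ℕ) → (Fin n → Fin q) → Fin q
  ∑ zero    f = 0#
  ∑ (suc n) f = f zero + ∑ n (λ i → f (suc i))

  Mat : ℕ → ℕ → Set
  Mat a b = Fin a → Fin b → Fin q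

  _⊗_ : ∀ {a b c} → Mat a b → Mat b c → Mat a c
  _⊗_ {b = b} X Y i k = ∑ b (λ j → X i j * Y j k)

  permMat : ∀ {m} → (Fin m → Fin m) → Mat m m
  permMat ρ i j = if ⌊ ρ i ≟ j ⌋ then 1# else 0#

  eqMatᵇ : ∀ {a b} → Mat a b → Mat a b → Bool
  eqMatᵇ {a} {b} X Y =
    allᵇ (λ i → allᵇ (λ j → ⌊ X i j ≟ Y i j ⌋) (allFin b)) (allFin a)

allFuns : ∀ {A : Set} (n : ℕ) → List A → List (Fin n → A)
allFuns zero    xs = (λ ()) ∷ []
allFuns (suc n) xs =
  concatMap (λ x → map (λ f → λ { zero → x ; (suc i) → f i }) (allFuns n xs)) xs

injectiveᵇ : ∀ {m} → (Fin m → Fin m) → Bool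
injectiveᵇ {m} ρ =
  allᵇ (λ i → allᵇ (λ j → not ⌊ ρ i ≟ ρ j ⌋ Data.Bool.∨ ⌊ i ≟ j ⌋) (allFin m)) (allFin m)

Sym : (m : ℕ) → List (Fin m → Fin m)
Sym m = filterᵇ injectiveᵇ (allFuns m (allFin m))

module _ {q : ℕ} (F : FiniteField q) where
  open FiniteField F

  allVecs : (n : ℕ) → List (Fin n → Fin q)
  allVecs n = allFuns n (allFin q)

  allMats : (a b : ℕ) → List (Mat F a b)
  allMats a b = allFuns a (allVecs b)

  isZeroVecᵇ : ∀ {n} → (Fin n → Fin q) → Bool
  isZeroVecᵇ {n} v = allᵇ (λ i → ⌊ v i ≟ 0# ⌋) (allFin n)

  -- rank of an ℓ×m matrix is exactly ℓ iff its ℓ rows are linearly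
  -- independent: the only c with c^T A = 0 is c = 0.
  fullRowRankᵇ : ∀ {ℓ m} → Mat F ℓ m → Bool
  fullRowRankᵇ {ℓ} {m} A =
    allᵇ (λ c → not (isZeroVecᵇ (λ j → ∑ F ℓ (λ i → c i * A i j))) Data.Bool.∨ isZeroVecᵇ c)
          (allVecs ℓ)

  RankFull : (ℓ m : ℕ) → List (Mat F ℓ m)
  RankFull ℓ m = filterᵇ fullRowRankᵇ (allMats ℓ m)

  -- F_q^{⋆ m×1, 1}: column vectors of rank exactly 1 (i.e. nonzero) whose
  -- rows (entries) are nonzero and pairwise distinct.
  starColᵇ : ∀ {m} → Mat F m 1 → Bool
  starColᵇ {m} B =
    allᵇ (λ i → not ⌊ B i zero ≟ 0# ⌋) (allFin m) ∧
    allᵇ (λ i → allᵇ (λ j → not ⌊ B i zero ≟ B j zero ⌋ Data.Bool.∨ ⌊ i ≟ j ⌋) (allFin m)) (allFin m)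
    ∧ not (isZeroVecᵇ (λ i → B i zero))

  StarCol : (m : ℕ) → List (Mat F m 1)
  StarCol m = filterᵇ starColᵇ (allMats m 1)

  Nsol : ∀ {ℓ m} → Mat F ℓ m → Mat F m 1 → Mat F ℓ 1 → ℕ
  Nsol {ℓ} {m} A B C =
    length (filterᵇ (λ ρ → eqMatᵇ F (_⊗_ F (_⊗_ F A (permMat F ρ)) B) C) (Sym m))

-- n // d  =  n / d  as a rational (with the convention x // 0 = 0; only used
-- with d ≠ 0)
_//_ : ℤ → ℕ → ℚ
n // zero  = 0ℚ
n // suc d = n / suc d

module _ {q : ℕ} (F : FiniteField q) where

  totalNsol : (ℓ m : ℕ) → ℕ
  totalNsol ℓ m =
    sumℕ (map (λ A → sumℕ (map (λ B → sumℕ (map (λ π →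
        Nsol F A B (_⊗_ F (_⊗_ F A (permMat F π)) B)) (Sym m)))
      (StarCol F m))) (RankFull F ℓ m))

  expectedNsol : (ℓ m : ℕ) → ℚ
  expectedNsol ℓ m =
    (ℤ.+ totalNsol ℓ m) //
      (length (RankFull F ℓ m) ℕ.* length (StarCol F m) ℕ.* length (Sym m))

{-# OPTIONS --safe #-}
module Submission where

-- Since AρB − AπB = A d with d = ρB − πB, summing N_sol over A
-- gives, for fixed B and π, the sum over ρ of the number of full-rank A with
-- A d = 0.  For ρ = π this is every full-rank A.  For ρ ≠ π the entries of B
-- are distinct, so some d_k ≠ 0, and deleting column k is a bijection from
-- {A full rank, A d = 0} onto the full-rank ℓ × (m − 1) matrices: the deleted
-- column is recovered from A d = 0.  Counting full-rank matrices row by row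
-- (a new row must avoid the q^i vectors spanned by the previous i rows) gives
-- R(ℓ, m) = ∏_{i<ℓ} (q^m − q^i), so each of the m! − 1 permutations ρ ≠ π
-- contributes R(ℓ, m − 1)/R(ℓ, m) = (q^(m−ℓ) − 1)/(q^m − 1) to the expectation.

open import Defs
open import Algebra.Bundles using (CommutativeRing)
open import Data.Bool using (Bool; true; false; T; _∧_; _∨_; not; if_then_else_)
open import Data.Bool.Properties using (T-∧; T-≡)
open import Data.Empty using (⊥-elim)
open import Data.Fin using (Fin; zero; suc; punchIn; punchOut; inject≤)
open import Data.Fin.Properties
  using (≡-decSetoid; _≟_; suc-injective; 0≢1+n; all?; ¬∀⟶∃¬; punchInᵢ≢i; punchIn-punchOut;
         punchIn-injective; inject≤-injective)
open import Data.List using (List; []; _∷_; _++_; map; concatMap; filterᵇ; length; allFin; tabulate)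
open import Data.List.Properties using (map-tabulate; length-tabulate)
open import Data.List.Relation.Unary.All as All using (All; []; _∷_; lookupAny)
open import Data.List.Relation.Unary.All.Properties using (tabulate⁺; tabulate⁻)
open import Data.List.Relation.Unary.Any as Any using (Any; here; there; satisfied)
open import Data.List.Relation.Unary.Any.Properties using (lookup-result)
open import Data.Nat as ℕ using (ℕ; zero; suc; _∸_; _^_; _≤_; _<_; z≤n; s≤s; _!)
import Data.Nat.Properties as ℕ
open import Data.Product using (_×_; _,_; proj₁; proj₂; ∃)
open import Data.Product.Function.NonDependent.Propositional using (_×-⇔_)
open import Data.Vec.Functional as V using (Vector; removeAt; insertAt)
open import Data.Vec.Functional.Properties using (insertAt-lookup; insertAt-punchIn)
import Data.Vec.Functional.Relation.Binary.Pointwise.Properties as Pointwise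
open import Function using (_∘_; _$_; id; const; _⇔_; mk⇔; Equivalence)
open import Function.Definitions using (Injective)
open import Function.Properties.Equivalence using () renaming (sym to ⇔-sym; trans to ⇔-trans)
open import Function.Related.TypeIsomorphisms using (→-cong-⇔; ¬-cong-⇔)
open import Level using (0ℓ)
open import Relation.Binary using (DecSetoid; _Preserves_⟶_)
open import Relation.Binary.PropositionalEquality hiding ([_])
open import Relation.Nullary using (¬_)
open import Relation.Nullary.Decidable
  using (Dec; _because_; yes; no; ⌊_⌋; map′; ¬?; _×-dec_; _→-dec_; does-⇔; isYes≗does; dec-false;
         ⌊⌋-map′; toWitness; fromWitness; decidable-stable)
open import Relation.Nullary.Decidable.Core using (T?)

T-injective : ∀ {a b} → T a ⇔ T b → a ≡ b
T-injective {a} {b} a⇔b = does-⇔ a⇔b (T? a) (T? b)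

T-⌊⌋ : ∀ {A : Set} (a? : Dec A) → T ⌊ a? ⌋ ⇔ A
T-⌊⌋ a? = mk⇔ toWitness fromWitness

⌊⌋-⇔ : ∀ {A B : Set} → A ⇔ B → (a? : Dec A) (b? : Dec B) → ⌊ a? ⌋ ≡ ⌊ b? ⌋
⌊⌋-⇔ A⇔B a? b? = trans (isYes≗does a?) (trans (does-⇔ A⇔B a? b?) (sym (isYes≗does b?)))

⌊⌋-×-dec : ∀ {A B : Set} (a? : Dec A) (b? : Dec B) → ⌊ a? ×-dec b? ⌋ ≡ ⌊ a? ⌋ ∧ ⌊ b? ⌋
⌊⌋-×-dec (true  because _) (true  because _) = refl
⌊⌋-×-dec (true  because _) (false because _) = refl
⌊⌋-×-dec (false because _) _                 = refl

⌊⌋-no : ∀ {A : Set} (a? : Dec A) → ¬ A → ⌊ a? ⌋ ≡ false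
⌊⌋-no a? ¬a = trans (isYes≗does a?) (dec-false a? ¬a)

T-not : ∀ b → T (not b) ⇔ (¬ T b)
T-not true  = mk⇔ (λ ()) (λ ¬t → ¬t _)
T-not false = mk⇔ (λ _ ()) (λ _ → _)

T-→ : ∀ a b → T (not a ∨ b) ⇔ (T a → T b)
T-→ true  b = mk⇔ (λ t _ → t) (λ a→b → a→b _)
T-→ false b = mk⇔ (λ _ ()) (λ _ → _)

∀-⇔ : ∀ {A : Set} {P Q : A → Set} → (∀ x → P x ⇔ Q x) → (∀ x → P x) ⇔ (∀ x → Q x)
∀-⇔ P⇔Q = mk⇔ (λ p x → Equivalence.to (P⇔Q x) (p x)) (λ q x → Equivalence.from (P⇔Q x) (q x))

T-allᵇ : ∀ {A : Set} (p : A → Bool) xs → T (allᵇ p xs) ⇔ All (T ∘ p) xs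
T-allᵇ p xs = mk⇔ (to xs) (from xs)
  where
  to : ∀ xs → T (allᵇ p xs) → All (T ∘ p) xs
  to []       _ = []
  to (x ∷ xs) t = let px , pxs = Equivalence.to T-∧ t in px ∷ to xs pxs
  from : ∀ xs → All (T ∘ p) xs → T (allᵇ p xs)
  from []       _          = _
  from (x ∷ xs) (px ∷ pxs) = Equivalence.from T-∧ (px , from xs pxs)

T-allᵇ-allFin : ∀ {n} (p : Fin n → Bool) → T (allᵇ p (allFin n)) ⇔ (∀ i → T (p i))
T-allᵇ-allFin p = mk⇔ (tabulate⁻ ∘ Equivalence.to (T-allᵇ p _)) (Equivalence.from (T-allᵇ p _) ∘ tabulate⁺)

T-allᵇ-injective : ∀ {n k} (f : Fin n → Fin k) →
  T (allᵇ (λ i → allᵇ (λ j → not ⌊ f i ≟ f j ⌋ ∨ ⌊ i ≟ j ⌋) (allFin n)) (allFin n)) ⇔ Injective _≡_ _≡_ f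
T-allᵇ-injective f =
  ⇔-trans (⇔-trans (T-allᵇ-allFin _) (∀-⇔ λ i → ⇔-trans (T-allᵇ-allFin _) (∀-⇔ λ j →
            ⇔-trans (T-→ _ _) (→-cong-⇔ (T-⌊⌋ (f i ≟ f j)) (T-⌊⌋ (i ≟ j))))))
          (mk⇔ (λ inj {i} {j} → inj i j) (λ inj i j → inj))

injective-resp-≗ : ∀ {n k} {f g : Fin n → Fin k} → f ≗ g → Injective _≡_ _≡_ f → Injective _≡_ _≡_ g
injective-resp-≗ f≗g inj {i} {j} gi≡gj = inj (trans (f≗g i) (trans gi≡gj (sym (f≗g j))))

-- Counting with natural numbers

-- A block of its own, so that ℕ's _+_ and _*_ stay out of scope of the field modules below.
module _ where

  open import Data.Nat using (_+_; _*_)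
  open import Data.Nat.Properties
    using (+-assoc; +-identityʳ; *-comm; *-zeroʳ; *-identityˡ; *-identityʳ; *-distribˡ-+; *-distribˡ-∸;
           *-mono-≤; ^-distribˡ-+-*; ^-monoʳ-<; ≤-refl; ≤-reflexive; ≤-trans; <⇒≤; m≤m+n; m≤n+m;
           m+n∸n≡m; m+[n∸m]≡n; m<n⇒0<n∸m; ≤⇒≤ᵇ; 1≤n!)
  import Data.Integer as ℤ
  import Data.Integer.Properties as ℤ
  open import Data.Rational as ℚ using (1ℚ; toℚᵘ; fromℚᵘ)
  import Data.Rational.Properties as ℚ
  open import Data.Rational.Unnormalised as ℚᵘ using (mkℚᵘ; *≡*)
  import Data.Rational.Unnormalised.Properties as ℚᵘ
  open import Data.Nat.Combinatorics using (nPn≡n!)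
  open import Data.Nat.Combinatorics.Base using (_P′_)
  open import Data.Nat.Solver using (module +-*-Solver)
  open +-*-Solver using (solve; _:+_; _:*_; _:=_)

  private variable
    X Y : Set

  [_] : Bool → ℕ
  [ true ]  = 1
  [ false ] = 0

  Σ : List X → (X → ℕ) → ℕ
  Σ xs f = sumℕ (map f xs)

  syntax Σ xs (λ x → e) = Σ[ x ← xs ] e

  Σ-cong : ∀ (xs : List X) {f g : X → ℕ} → f ≗ g → Σ xs f ≡ Σ xs g
  Σ-cong []       f≗g = refl
  Σ-cong (x ∷ xs) f≗g = cong₂ _+_ (f≗g x) (Σ-cong xs f≗g)

  Σ-+ : ∀ (xs : List X) (f g : X → ℕ) → Σ[ x ← xs ] (f x + g x) ≡ Σ xs f + Σ xs g
  Σ-+ []       f g = refl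
  Σ-+ (x ∷ xs) f g = trans (cong (f x + g x +_) (Σ-+ xs f g)) (interchange (f x) (g x) _ _)
    where
    interchange : ∀ a b c d → (a + b) + (c + d) ≡ (a + c) + (b + d)
    interchange = solve 4 (λ a b c d → (a :+ b) :+ (c :+ d) := (a :+ c) :+ (b :+ d)) refl

  Σ-*ˡ : ∀ (xs : List X) c (f : X → ℕ) → Σ[ x ← xs ] (c * f x) ≡ c * Σ xs f
  Σ-*ˡ []       c f = sym (*-zeroʳ c)
  Σ-*ˡ (x ∷ xs) c f = trans (cong (c * f x +_) (Σ-*ˡ xs c f)) (sym (*-distribˡ-+ c (f x) _))

  Σ-*ʳ : ∀ (xs : List X) c (f : X → ℕ) → Σ[ x ← xs ] (f x * c) ≡ Σ xs f * c
  Σ-*ʳ xs c f = trans (Σ-cong xs (λ x → *-comm (f x) c)) (trans (Σ-*ˡ xs c f) (*-comm c _))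

  Σ-const : ∀ (xs : List X) c → Σ xs (const c) ≡ length xs * c
  Σ-const []       c = refl
  Σ-const (x ∷ xs) c = cong (c +_) (Σ-const xs c)

  length≡Σ1 : ∀ (xs : List X) → length xs ≡ Σ xs (const 1)
  length≡Σ1 xs = sym (trans (Σ-const xs 1) (*-identityʳ (length xs)))

  Σ-zero : ∀ (xs : List X) {f : X → ℕ} → (∀ x → f x ≡ 0) → Σ xs f ≡ 0
  Σ-zero xs f≗0 = trans (Σ-cong xs f≗0) (trans (Σ-const xs 0) (*-zeroʳ (length xs)))

  Σ-swap : ∀ (xs : List X) (ys : List Y) (f : X → Y → ℕ) →
    Σ[ x ← xs ] Σ[ y ← ys ] f x y ≡ Σ[ y ← ys ] Σ[ x ← xs ] f x y
  Σ-swap []       ys f = sym (Σ-zero ys (λ _ → refl))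
  Σ-swap (x ∷ xs) ys f = trans (cong (Σ ys (f x) +_) (Σ-swap xs ys f))
                               (sym (Σ-+ ys (f x) (λ y → Σ[ x′ ← xs ] f x′ y)))

  Σ-++ : ∀ (xs ys : List X) (f : X → ℕ) → Σ (xs ++ ys) f ≡ Σ xs f + Σ ys f
  Σ-++ []       ys f = refl
  Σ-++ (x ∷ xs) ys f = trans (cong (f x +_) (Σ-++ xs ys f)) (sym (+-assoc (f x) _ _))

  Σ-map : ∀ (xs : List X) (h : X → Y) (f : Y → ℕ) → Σ (map h xs) f ≡ Σ xs (f ∘ h)
  Σ-map []       h f = refl
  Σ-map (x ∷ xs) h f = cong (f (h x) +_) (Σ-map xs h f)

  Σ-concatMap : ∀ (xs : List X) (g : X → List Y) (f : Y → ℕ) → Σ (concatMap g xs) f ≡ Σ[ x ← xs ] Σ (g x) f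
  Σ-concatMap []       g f = refl
  Σ-concatMap (x ∷ xs) g f = trans (Σ-++ (g x) (concatMap g xs) f) (cong (Σ (g x) f +_) (Σ-concatMap xs g f))

  Σ-filterᵇ : ∀ (xs : List X) (p : X → Bool) (f : X → ℕ) → Σ (filterᵇ p xs) f ≡ Σ[ x ← xs ] ([ p x ] * f x)
  Σ-filterᵇ []       p f = refl
  Σ-filterᵇ (x ∷ xs) p f with p x
  ... | true  = cong₂ _+_ (sym (+-identityʳ (f x))) (Σ-filterᵇ xs p f)
  ... | false = Σ-filterᵇ xs p f

  length-filterᵇ : ∀ (xs : List X) (p : X → Bool) → length (filterᵇ p xs) ≡ Σ[ x ← xs ] [ p x ]
  length-filterᵇ xs p = trans (length≡Σ1 (filterᵇ p xs))
    (trans (Σ-filterᵇ xs p (const 1)) (Σ-cong xs (λ x → *-identityʳ [ p x ])))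

  Σ-filterᵇ-cong : ∀ (xs : List X) (p : X → Bool) {f g : X → ℕ} →
    (∀ x → T (p x) → f x ≡ g x) → Σ (filterᵇ p xs) f ≡ Σ (filterᵇ p xs) g
  Σ-filterᵇ-cong []       p f≗g = refl
  Σ-filterᵇ-cong (x ∷ xs) p f≗g with p x in px
  ... | true  = cong₂ _+_ (f≗g x (subst T (sym px) _)) (Σ-filterᵇ-cong xs p f≗g)
  ... | false = Σ-filterᵇ-cong xs p f≗g

  Σ-lookup-≤ : ∀ {P : X → Set} {xs : List X} (f : X → ℕ) (i : Any P xs) → f (Any.lookup i) ≤ Σ xs f
  Σ-lookup-≤ f (here _)  = m≤m+n _ _
  Σ-lookup-≤ f (there i) = ≤-trans (Σ-lookup-≤ f i) (m≤n+m _ _)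

  Σ-positive⇒Any : ∀ (xs : List X) (p : X → Bool) → 0 < Σ[ x ← xs ] [ p x ] → Any (T ∘ p) xs
  Σ-positive⇒Any (x ∷ xs) p pos with p x in px
  ... | true  = here (subst T (sym px) _)
  ... | false = there (Σ-positive⇒Any xs p pos)

  [∧] : ∀ a b → [ a ∧ b ] ≡ [ a ] * [ b ]
  [∧] true  b = sym (+-identityʳ [ b ])
  [∧] false b = refl

  []+[not]≡1 : ∀ b → [ b ] + [ not b ] ≡ 1
  []+[not]≡1 true  = refl
  []+[not]≡1 false = refl

  Σ-[]+Σ-[not] : ∀ (xs : List X) (p : X → Bool) → Σ[ x ← xs ] [ p x ] + Σ[ x ← xs ] [ not (p x) ] ≡ length xs
  Σ-[]+Σ-[not] xs p = trans (sym (Σ-+ xs _ _)) (trans (Σ-cong xs ([]+[not]≡1 ∘ p)) (sym (length≡Σ1 xs)))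

  []≡1 : ∀ {b} → T b → [ b ] ≡ 1
  []≡1 {true} _ = refl

  []≡0 : ∀ {b} → ¬ T b → [ b ] ≡ 0
  []≡0 {true}  ¬t = ⊥-elim (¬t _)
  []≡0 {false} _  = refl

  []*-cong : ∀ b {m n} → (T b → m ≡ n) → [ b ] * m ≡ [ b ] * n
  []*-cong true  m≡n = cong (_+ 0) (m≡n _)
  []*-cong false m≡n = refl

  -- Matrices, vectors and permutations are functions, listed by allFuns and compared pointwise:
  -- an enumeration lists every element exactly once up to a decidable equivalence, and every
  -- predicate that is counted over it must respect that equivalence.
  record Enumerates (S : DecSetoid 0ℓ 0ℓ) (xs : List (DecSetoid.Carrier S)) : Set where
    constructor enumerates
    open DecSetoid S using () renaming (_≟_ to _≈?_)
    field
      occurs-once : ∀ z → Σ[ x ← xs ] [ ⌊ x ≈? z ⌋ ] ≡ 1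

  open Enumerates public

  module _ (S : DecSetoid 0ℓ 0ℓ) where

    open DecSetoid S using (_≈_) renaming (Carrier to C; sym to ≈-sym)

    preserves-via : (p : C → Bool) (P : C → Set) → (∀ x → T (p x) ⇔ P x) →
      (∀ {x y} → x ≈ y → P x → P y) → p Preserves _≈_ ⟶ _≡_
    preserves-via p P p⇔P P-resp x≈y = T-injective (mk⇔
      (Equivalence.from (p⇔P _) ∘ P-resp x≈y ∘ Equivalence.to (p⇔P _))
      (Equivalence.from (p⇔P _) ∘ P-resp (≈-sym x≈y) ∘ Equivalence.to (p⇔P _)))

  module _ {S : DecSetoid 0ℓ 0ℓ} {xs : List (DecSetoid.Carrier S)} (enum : Enumerates S xs) where

    open DecSetoid S using (_≈_) renaming (Carrier to C; _≟_ to _≈?_)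

    Σ-pick : (h : C → ℕ) → h Preserves _≈_ ⟶ _≡_ → ∀ z → Σ[ x ← xs ] ([ ⌊ x ≈? z ⌋ ] * h x) ≡ h z
    Σ-pick h h-resp z = begin
      Σ[ x ← xs ] ([ ⌊ x ≈? z ⌋ ] * h x)  ≡⟨ Σ-cong xs pick ⟩
      Σ[ x ← xs ] ([ ⌊ x ≈? z ⌋ ] * h z)  ≡⟨ Σ-*ʳ xs (h z) _ ⟩
      Σ[ x ← xs ] [ ⌊ x ≈? z ⌋ ] * h z    ≡⟨ cong (_* h z) (occurs-once enum z) ⟩
      1 * h z                            ≡⟨ *-identityˡ (h z) ⟩
      h z                                ∎
      where
      open ≡-Reasoning
      pick : ∀ x → [ ⌊ x ≈? z ⌋ ] * h x ≡ [ ⌊ x ≈? z ⌋ ] * h z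
      pick x with x ≈? z
      ... | yes x≈z = cong (_+ 0) (h-resp x≈z)
      ... | no _    = refl

    covers : ∀ z → Any (_≈ z) xs
    covers z = Any.map toWitness (Σ-positive⇒Any xs (λ x → ⌊ x ≈? z ⌋) (≤-reflexive (sym (occurs-once enum z))))

    allᵇ-enumeration : (p : C → Bool) → p Preserves _≈_ ⟶ _≡_ → T (allᵇ p xs) ⇔ (∀ z → T (p z))
    allᵇ-enumeration p p-resp =
      mk⇔ everywhere (λ p-all → Equivalence.from (T-allᵇ p xs) (All.tabulate (λ _ → p-all _)))
      where
      everywhere : T (allᵇ p xs) → ∀ z → T (p z)
      everywhere t z = let px , x≈z = lookupAny (Equivalence.to (T-allᵇ p xs) t) (covers z)
                       in subst T (p-resp x≈z) px

    Σ-positive : (p : C → Bool) → p Preserves _≈_ ⟶ _≡_ → ∀ z → T (p z) → 0 < Σ[ x ← xs ] [ p x ]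
    Σ-positive p p-resp z pz =
      ≤-trans (≤-reflexive (sym (trans (cong [_] (p-resp (lookup-result (covers z)))) ([]≡1 pz))))
              (Σ-lookup-≤ (λ x → [ p x ]) (covers z))

  Σ-allFin-suc : ∀ {n} (f : Fin (suc n) → ℕ) → Σ (allFin (suc n)) f ≡ f zero + Σ (allFin n) (f ∘ suc)
  Σ-allFin-suc {n} f =
    cong (f zero +_) (trans (cong (λ ys → Σ ys f) (sym (map-tabulate id suc))) (Σ-map (allFin n) suc f))

  Σ-allFin-1 : ∀ n → Σ (allFin n) (const 1) ≡ n
  Σ-allFin-1 n = trans (sym (length≡Σ1 (allFin n))) (length-tabulate id)

  allFin-enumerates : ∀ n → Enumerates (≡-decSetoid n) (allFin n)
  allFin-enumerates n = enumerates (once n)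
    where
    once : ∀ n (z : Fin n) → Σ[ x ← allFin n ] [ ⌊ x ≟ z ⌋ ] ≡ 1
    once (suc n) zero    = trans (Σ-allFin-suc {n} (λ x → [ ⌊ x ≟ zero ⌋ ]))
                                 (cong suc (Σ-zero (allFin n) (λ _ → refl)))
    once (suc n) (suc z) = trans (Σ-allFin-suc {n} (λ x → [ ⌊ x ≟ suc z ⌋ ]))
                                 (trans (Σ-cong (allFin n) (λ x → cong [_] (⌊⌋-map′ _ _ (x ≟ z)))) (once n z))

  Σ-allFuns : ∀ {n} (xs : List X) (g : Vector X (suc n) → ℕ) → g Preserves _≗_ ⟶ _≡_ →
    Σ (allFuns (suc n) xs) g ≡ Σ[ x ← xs ] Σ[ f ← allFuns n xs ] g (x V.∷ f)
  Σ-allFuns {n = n} xs g g-resp = trans (Σ-concatMap xs _ g) (Σ-cong xs λ x →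
    trans (Σ-map (allFuns n xs) _ g) (Σ-cong (allFuns n xs) λ f → g-resp λ { zero → refl ; (suc i) → refl }))

  length-allFuns : ∀ n (xs : List X) → length (allFuns n xs) ≡ length xs ^ n
  length-allFuns zero    xs = refl
  length-allFuns (suc n) xs = begin
    length (allFuns (suc n) xs)            ≡⟨ length≡Σ1 (allFuns (suc n) xs) ⟩
    Σ (allFuns (suc n) xs) (const 1)       ≡⟨ Σ-allFuns xs (const 1) (const refl) ⟩
    Σ[ x ← xs ] Σ (allFuns n xs) (const 1) ≡⟨ Σ-cong xs (λ _ → sym (length≡Σ1 (allFuns n xs))) ⟩
    Σ[ x ← xs ] length (allFuns n xs)      ≡⟨ Σ-const xs _ ⟩
    length xs * length (allFuns n xs)      ≡⟨ cong (length xs *_) (length-allFuns n xs) ⟩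
    length xs * length xs ^ n              ∎
    where open ≡-Reasoning

  pointwise : DecSetoid 0ℓ 0ℓ → ℕ → DecSetoid 0ℓ 0ℓ
  pointwise = Pointwise.decSetoid

  module _ {S : DecSetoid 0ℓ 0ℓ} where

    open DecSetoid S using (_≈_) renaming (Carrier to C; _≟_ to _≈?_)

    private
      module Sⁿ {n} = DecSetoid (pointwise S n) renaming (_≟_ to _≈?_)

    ≈?-∷ : ∀ {n} x (f : Vector C n) z →
      ⌊ (x V.∷ f) Sⁿ.≈? z ⌋ ≡ ⌊ x ≈? z zero ⌋ ∧ ⌊ f Sⁿ.≈? (z ∘ suc) ⌋
    ≈?-∷ x f z =
      trans (⌊⌋-⇔ pointwise-∷ ((x V.∷ f) Sⁿ.≈? z) ((x ≈? z zero) ×-dec (f Sⁿ.≈? (z ∘ suc))))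
            (⌊⌋-×-dec (x ≈? z zero) (f Sⁿ.≈? (z ∘ suc)))
      where
      pointwise-∷ : (x V.∷ f) Sⁿ.≈ z ⇔ (x ≈ z zero × f Sⁿ.≈ (z ∘ suc))
      pointwise-∷ = mk⇔ (λ x∷f≈z → x∷f≈z zero , x∷f≈z ∘ suc)
                        λ { (x≈z₀ , f≈z₊) → λ { zero → x≈z₀ ; (suc i) → f≈z₊ i } }

    ≈?-resp-≗ : ∀ {n} (z : Vector C n) → (λ f → [ ⌊ f Sⁿ.≈? z ⌋ ]) Preserves _≗_ ⟶ _≡_
    ≈?-resp-≗ z {f} {f′} f≗f′ = cong [_] (⌊⌋-⇔
      (mk⇔ (λ f≈z i → subst (_≈ z i) (f≗f′ i) (f≈z i))
           (λ f′≈z i → subst (_≈ z i) (sym (f≗f′ i)) (f′≈z i)))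
      (f Sⁿ.≈? z) (f′ Sⁿ.≈? z))

    allFuns-enumerates : ∀ n {xs} → Enumerates S xs → Enumerates (pointwise S n) (allFuns n xs)
    allFuns-enumerates n {xs} enum = enumerates (once n)
      where
      once : ∀ n (z : Vector C n) → Σ[ f ← allFuns n xs ] [ ⌊ f Sⁿ.≈? z ⌋ ] ≡ 1
      once zero    z = refl
      once (suc n) z = begin
        Σ[ f ← allFuns (suc n) xs ] [ ⌊ f Sⁿ.≈? z ⌋ ]
          ≡⟨ Σ-allFuns xs _ (≈?-resp-≗ z) ⟩
        Σ[ x ← xs ] Σ[ f ← allFuns n xs ] [ ⌊ (x V.∷ f) Sⁿ.≈? z ⌋ ]
          ≡⟨ Σ-cong xs (λ x → Σ-cong (allFuns n xs) (λ f →
               trans (cong [_] (≈?-∷ x f z)) ([∧] ⌊ x ≈? z zero ⌋ ⌊ f Sⁿ.≈? (z ∘ suc) ⌋))) ⟩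
        Σ[ x ← xs ] Σ[ f ← allFuns n xs ] ([ ⌊ x ≈? z zero ⌋ ] * [ ⌊ f Sⁿ.≈? (z ∘ suc) ⌋ ])
          ≡⟨ Σ-cong xs (λ x → Σ-*ˡ (allFuns n xs) [ ⌊ x ≈? z zero ⌋ ] _) ⟩
        Σ[ x ← xs ] ([ ⌊ x ≈? z zero ⌋ ] * Σ[ f ← allFuns n xs ] [ ⌊ f Sⁿ.≈? (z ∘ suc) ⌋ ])
          ≡⟨ Σ-cong xs (λ x → cong ([ ⌊ x ≈? z zero ⌋ ] *_) (once n (z ∘ suc))) ⟩
        Σ[ x ← xs ] ([ ⌊ x ≈? z zero ⌋ ] * 1)
          ≡⟨ Σ-cong xs (λ x → *-identityʳ [ ⌊ x ≈? z zero ⌋ ]) ⟩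
        Σ[ x ← xs ] [ ⌊ x ≈? z zero ⌋ ]
          ≡⟨ occurs-once enum (z zero) ⟩
        1 ∎
        where open ≡-Reasoning

  module _ (S R : DecSetoid 0ℓ 0ℓ) where

    private
      module S = DecSetoid S renaming (_≟_ to _≈?_)
      module R = DecSetoid R renaming (_≟_ to _≈?_)

    record BijectionOn (p : S.Carrier → Bool) (r : R.Carrier → Bool) : Set where
      field
        to        : S.Carrier → R.Carrier
        from      : R.Carrier → S.Carrier
        to-cong   : to Preserves S._≈_ ⟶ R._≈_
        from-cong : from Preserves R._≈_ ⟶ S._≈_
        to-maps   : ∀ x → T (p x) → T (r (to x))
        from-maps : ∀ y → T (r y) → T (p (from y))
        from∘to   : ∀ x → T (p x) → from (to x) S.≈ x
        to∘from   : ∀ y → T (r y) → to (from y) R.≈ y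

    Σ-bijection : ∀ {xs ys} → Enumerates S xs → Enumerates R ys →
      (p : S.Carrier → Bool) (r : R.Carrier → Bool) → p Preserves S._≈_ ⟶ _≡_ → r Preserves R._≈_ ⟶ _≡_ →
      BijectionOn p r → Σ[ x ← xs ] [ p x ] ≡ Σ[ y ← ys ] [ r y ]
    Σ-bijection {xs} {ys} enumS enumR p r p-resp r-resp bij = begin
      Σ[ x ← xs ] [ p x ]
        ≡⟨ Σ-cong xs (λ x → sym (trans (cong ([ p x ] *_) (occurs-once enumR (to x))) (*-identityʳ [ p x ]))) ⟩
      Σ[ x ← xs ] ([ p x ] * Σ[ y ← ys ] [ ⌊ y R.≈? to x ⌋ ])
        ≡⟨ Σ-cong xs (λ x → sym (Σ-*ˡ ys [ p x ] _)) ⟩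
      Σ[ x ← xs ] Σ[ y ← ys ] ([ p x ] * [ ⌊ y R.≈? to x ⌋ ])
        ≡⟨ Σ-swap xs ys _ ⟩
      Σ[ y ← ys ] Σ[ x ← xs ] ([ p x ] * [ ⌊ y R.≈? to x ⌋ ])
        ≡⟨ Σ-cong ys (λ y → Σ-cong xs (λ x → matched x y)) ⟩
      Σ[ y ← ys ] Σ[ x ← xs ] ([ r y ] * [ ⌊ x S.≈? from y ⌋ ])
        ≡⟨ Σ-cong ys (λ y → Σ-*ˡ xs [ r y ] _) ⟩
      Σ[ y ← ys ] ([ r y ] * Σ[ x ← xs ] [ ⌊ x S.≈? from y ⌋ ])
        ≡⟨ Σ-cong ys (λ y → trans (cong ([ r y ] *_) (occurs-once enumS (from y))) (*-identityʳ [ r y ])) ⟩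
      Σ[ y ← ys ] [ r y ] ∎
      where
      open ≡-Reasoning
      open BijectionOn bij
      matched : ∀ x y → [ p x ] * [ ⌊ y R.≈? to x ⌋ ] ≡ [ r y ] * [ ⌊ x S.≈? from y ⌋ ]
      matched x y = begin
        [ p x ] * [ ⌊ y R.≈? to x ⌋ ]   ≡⟨ [∧] (p x) _ ⟨
        [ p x ∧ ⌊ y R.≈? to x ⌋ ]       ≡⟨ cong [_] (T-injective (mk⇔ forth back)) ⟩
        [ r y ∧ ⌊ x S.≈? from y ⌋ ]     ≡⟨ [∧] (r y) _ ⟩
        [ r y ] * [ ⌊ x S.≈? from y ⌋ ] ∎
        where
        forth : T (p x ∧ ⌊ y R.≈? to x ⌋) → T (r y ∧ ⌊ x S.≈? from y ⌋)
        forth t with Equivalence.to T-∧ t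
        ... | px , y≈?tox = let y≈tox = toWitness y≈?tox in Equivalence.from T-∧
          ( subst T (r-resp (R.sym y≈tox)) (to-maps x px)
          , fromWitness (S.trans (S.sym (from∘to x px)) (from-cong (R.sym y≈tox))) )
        back : T (r y ∧ ⌊ x S.≈? from y ⌋) → T (p x ∧ ⌊ y R.≈? to x ⌋)
        back t with Equivalence.to T-∧ t
        ... | ry , x≈?fromy = let x≈fromy = toWitness x≈?fromy in Equivalence.from T-∧
          ( subst T (p-resp (S.sym x≈fromy)) (from-maps y ry)
          , fromWitness (R.trans (R.sym (to∘from y ry)) (to-cong (S.sym x≈fromy))) )

  injective? : ∀ {n k} (f : Fin n → Fin k) → Dec (Injective _≡_ _≡_ f)
  injective? f = map′ (λ inj {i} {j} → inj i j) (λ inj i j → inj)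
                      (all? λ i → all? λ j → (f i ≟ f j) →-dec (i ≟ j))

  avoids? : ∀ {n k} (x : Fin k) (f : Fin n → Fin k) → Dec (∀ i → f i ≢ x)
  avoids? x f = all? λ i → ¬? (f i ≟ x)

  injective-∷ : ∀ {n k} (x : Fin k) (f : Fin n → Fin k) →
    Injective _≡_ _≡_ (x V.∷ f) ⇔ (Injective _≡_ _≡_ f × (∀ i → f i ≢ x))
  injective-∷ x f = mk⇔
    (λ inj → (λ {i} {j} fi≡fj → suc-injective (inj {suc i} {suc j} fi≡fj))
           , (λ i fi≡x → 0≢1+n (sym (inj {suc i} {zero} fi≡x))))
    (λ (inj , avoid) → λ { {zero}  {zero}  _     → refl
                         ; {zero}  {suc j} x≡fj  → ⊥-elim (avoid j (sym x≡fj))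
                         ; {suc i} {zero}  fi≡x  → ⊥-elim (avoid i fi≡x)
                         ; {suc i} {suc j} fi≡fj → cong suc (inj fi≡fj) })

  module _ {n k : ℕ} (f : Fin n → Fin k) where

    hits : Fin k → ℕ
    hits x = Σ[ i ← allFin n ] [ ⌊ x ≟ f i ⌋ ]

    Σ-hits : Σ (allFin k) hits ≡ n
    Σ-hits = begin
      Σ[ x ← allFin k ] Σ[ i ← allFin n ] [ ⌊ x ≟ f i ⌋ ]
        ≡⟨ Σ-swap (allFin k) (allFin n) _ ⟩
      Σ[ i ← allFin n ] Σ[ x ← allFin k ] [ ⌊ x ≟ f i ⌋ ]
        ≡⟨ Σ-cong (allFin n) (occurs-once (allFin-enumerates k) ∘ f) ⟩
      Σ (allFin n) (const 1)
        ≡⟨ Σ-allFin-1 n ⟩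
      n                                                   ∎
      where open ≡-Reasoning

    avoids+hits≡1 : Injective _≡_ _≡_ f → ∀ x → [ ⌊ avoids? x f ⌋ ] + hits x ≡ 1
    avoids+hits≡1 inj x with avoids? x f
    ... | yes avoid = cong suc (Σ-zero (allFin n) (λ i → cong [_] (⌊⌋-no (x ≟ f i) (avoid i ∘ sym))))
    ... | no ¬avoid = trans (Σ-cong (allFin n) (λ i → cong [_] (⌊⌋-⇔ hit⇔i≡i₀ (x ≟ f i) (i ≟ i₀))))
                            (occurs-once (allFin-enumerates n) i₀)
      where
      i₀ : Fin n
      i₀ = proj₁ (¬∀⟶∃¬ n _ (λ i → ¬? (f i ≟ x)) ¬avoid)
      fi₀≡x : f i₀ ≡ x
      fi₀≡x = decidable-stable (f i₀ ≟ x) (proj₂ (¬∀⟶∃¬ n _ (λ i → ¬? (f i ≟ x)) ¬avoid))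
      hit⇔i≡i₀ : ∀ {i} → x ≡ f i ⇔ i ≡ i₀
      hit⇔i≡i₀ = mk⇔ (λ x≡fi → inj (trans (sym x≡fi) (sym fi₀≡x)))
                     (λ i≡i₀ → trans (sym fi₀≡x) (cong f (sym i≡i₀)))

    Σ-avoids : Injective _≡_ _≡_ f → Σ[ x ← allFin k ] [ ⌊ avoids? x f ⌋ ] ≡ k ∸ n
    Σ-avoids inj = begin
      A                                                     ≡⟨ m+n∸n≡m A n ⟨
      A + n ∸ n                                             ≡⟨ cong (λ h → A + h ∸ n) Σ-hits ⟨
      A + Σ (allFin k) hits ∸ n                             ≡⟨ cong (_∸ n) (Σ-+ (allFin k) _ hits) ⟨
      Σ[ x ← allFin k ] ([ ⌊ avoids? x f ⌋ ] + hits x) ∸ n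
        ≡⟨ cong (_∸ n) (Σ-cong (allFin k) (avoids+hits≡1 inj)) ⟩
      Σ (allFin k) (const 1) ∸ n                            ≡⟨ cong (_∸ n) (Σ-allFin-1 k) ⟩
      k ∸ n                                                 ∎
      where
      open ≡-Reasoning
      A : ℕ
      A = Σ[ x ← allFin k ] [ ⌊ avoids? x f ⌋ ]

  count-injections : ∀ n k → Σ[ f ← allFuns n (allFin k) ] [ ⌊ injective? f ⌋ ] ≡ k P′ n
  count-injections zero    k = refl
  count-injections (suc n) k = begin
    Σ[ f ← allFuns (suc n) Ks ] [ ⌊ injective? f ⌋ ]
      ≡⟨ Σ-allFuns Ks _ (λ f≗g → cong [_]
           (⌊⌋-⇔ (mk⇔ (injective-resp-≗ f≗g) (injective-resp-≗ (sym ∘ f≗g))) (injective? _) (injective? _))) ⟩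
    Σ[ x ← Ks ] Σ[ f ← allFuns n Ks ] [ ⌊ injective? (x V.∷ f) ⌋ ]
      ≡⟨ Σ-cong Ks (λ x → Σ-cong (allFuns n Ks) (λ f → split x f)) ⟩
    Σ[ x ← Ks ] Σ[ f ← allFuns n Ks ] ([ ⌊ injective? f ⌋ ] * [ ⌊ avoids? x f ⌋ ])
      ≡⟨ Σ-swap Ks (allFuns n Ks) _ ⟩
    Σ[ f ← allFuns n Ks ] Σ[ x ← Ks ] ([ ⌊ injective? f ⌋ ] * [ ⌊ avoids? x f ⌋ ])
      ≡⟨ Σ-cong (allFuns n Ks) (λ f → Σ-*ˡ Ks [ ⌊ injective? f ⌋ ] _) ⟩
    Σ[ f ← allFuns n Ks ] ([ ⌊ injective? f ⌋ ] * Σ[ x ← Ks ] [ ⌊ avoids? x f ⌋ ])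
      ≡⟨ Σ-cong (allFuns n Ks) (λ f → []*-cong ⌊ injective? f ⌋ (Σ-avoids f ∘ toWitness)) ⟩
    Σ[ f ← allFuns n Ks ] ([ ⌊ injective? f ⌋ ] * (k ∸ n))
      ≡⟨ Σ-*ʳ (allFuns n Ks) (k ∸ n) _ ⟩
    Σ[ f ← allFuns n Ks ] [ ⌊ injective? f ⌋ ] * (k ∸ n)
      ≡⟨ cong (_* (k ∸ n)) (count-injections n k) ⟩
    (k P′ n) * (k ∸ n)
      ≡⟨ *-comm (k P′ n) (k ∸ n) ⟩
    k P′ suc n ∎
    where
    open ≡-Reasoning
    Ks : List (Fin k)
    Ks = allFin k
    split : ∀ x f → [ ⌊ injective? (x V.∷ f) ⌋ ] ≡ [ ⌊ injective? f ⌋ ] * [ ⌊ avoids? x f ⌋ ]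
    split x f = trans (cong [_] (trans (⌊⌋-⇔ (injective-∷ x f) _ (injective? f ×-dec avoids? x f))
                                       (⌊⌋-×-dec (injective? f) (avoids? x f))))
                      ([∧] ⌊ injective? f ⌋ _)

  P′-diagonal : ∀ n → n P′ n ≡ n !
  P′-diagonal n =
    trans (cong (λ b → if b then n P′ n else 0) (sym (Equivalence.to T-≡ (≤⇒≤ᵇ (≤-refl {n}))))) (nPn≡n! n)

  length-Sym : ∀ m → length (Sym m) ≡ m !
  length-Sym m = begin
    length (Sym m)                                     ≡⟨ length-filterᵇ ρs injectiveᵇ ⟩
    Σ[ ρ ← ρs ] [ injectiveᵇ ρ ]                       ≡⟨ Σ-cong ρs (cong [_] ∘ injectiveᵇ≡⌊injective?⌋) ⟩
    Σ[ ρ ← ρs ] [ ⌊ injective? ρ ⌋ ]                   ≡⟨ count-injections m m ⟩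
    m P′ m                                             ≡⟨ P′-diagonal m ⟩
    m !                                                ∎
    where
    open ≡-Reasoning
    ρs : List (Fin m → Fin m)
    ρs = allFuns m (allFin m)
    injectiveᵇ≡⌊injective?⌋ : ∀ ρ → injectiveᵇ ρ ≡ ⌊ injective? ρ ⌋
    injectiveᵇ≡⌊injective?⌋ ρ = T-injective (⇔-trans (T-allᵇ-injective ρ) (⇔-sym (T-⌊⌋ (injective? ρ))))

  Sym-nonempty : ∀ m → 0 < length (Sym m)
  Sym-nonempty m = subst (0 <_) (sym (length-Sym m)) (1≤n! m)

  fullRankCount : ℕ → ℕ → ℕ → ℕ
  fullRankCount q zero    m = 1
  fullRankCount q (suc ℓ) m = fullRankCount q ℓ m * (q ^ m ∸ q ^ ℓ)

  fullRankCount-suc : ∀ q ℓ m →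
    fullRankCount q (suc ℓ) (suc m) ≡ (q ^ suc m ∸ 1) * (q ^ ℓ * fullRankCount q ℓ m)
  fullRankCount-suc q zero    m = trans (*-identityˡ _) (sym (*-identityʳ _))
  fullRankCount-suc q (suc ℓ) m = begin
    fullRankCount q (suc ℓ) (suc m) * (q * q ^ m ∸ q * q ^ ℓ)
      ≡⟨ cong₂ _*_ (fullRankCount-suc q ℓ m) (sym (*-distribˡ-∸ q (q ^ m) (q ^ ℓ))) ⟩
    (q ^ suc m ∸ 1) * (q ^ ℓ * fullRankCount q ℓ m) * (q * (q ^ m ∸ q ^ ℓ))
      ≡⟨ solve 5 (λ d a p q x → d :* (a :* p) :* (q :* x) := d :* (q :* a :* (p :* x))) refl
               (q ^ suc m ∸ 1) (q ^ ℓ) (fullRankCount q ℓ m) q (q ^ m ∸ q ^ ℓ) ⟩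
    (q ^ suc m ∸ 1) * (q ^ suc ℓ * fullRankCount q (suc ℓ) m) ∎
    where open ≡-Reasoning

  ^-∸-^ : ∀ q {ℓ m} → ℓ ≤ m → q ^ m ∸ q ^ ℓ ≡ q ^ ℓ * (q ^ (m ∸ ℓ) ∸ 1)
  ^-∸-^ q {ℓ} {m} ℓ≤m = begin
    q ^ m ∸ q ^ ℓ                   ≡⟨ cong (λ n → q ^ n ∸ q ^ ℓ) (m+[n∸m]≡n ℓ≤m) ⟨
    q ^ (ℓ + (m ∸ ℓ)) ∸ q ^ ℓ       ≡⟨ cong₂ _∸_ (^-distribˡ-+-* q ℓ (m ∸ ℓ)) (sym (*-identityʳ (q ^ ℓ))) ⟩
    q ^ ℓ * q ^ (m ∸ ℓ) ∸ q ^ ℓ * 1 ≡⟨ *-distribˡ-∸ (q ^ ℓ) (q ^ (m ∸ ℓ)) 1 ⟨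
    q ^ ℓ * (q ^ (m ∸ ℓ) ∸ 1)       ∎
    where open ≡-Reasoning

  fullRankCount-ratio : ∀ q {ℓ m} → ℓ ≤ m →
    fullRankCount q (suc ℓ) m * (q ^ suc m ∸ 1) ≡ fullRankCount q (suc ℓ) (suc m) * (q ^ (m ∸ ℓ) ∸ 1)
  fullRankCount-ratio q {ℓ} {m} ℓ≤m = begin
    fullRankCount q ℓ m * (q ^ m ∸ q ^ ℓ) * D
      ≡⟨ cong (λ x → fullRankCount q ℓ m * x * D) (^-∸-^ q ℓ≤m) ⟩
    fullRankCount q ℓ m * (q ^ ℓ * E) * D
      ≡⟨ solve 4 (λ p a e d → p :* (a :* e) :* d := d :* (a :* p) :* e) refl (fullRankCount q ℓ m) (q ^ ℓ) E D ⟩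
    D * (q ^ ℓ * fullRankCount q ℓ m) * E
      ≡⟨ cong (_* E) (fullRankCount-suc q ℓ m) ⟨
    fullRankCount q (suc ℓ) (suc m) * E ∎
    where
    open ≡-Reasoning
    D E : ℕ
    D = q ^ suc m ∸ 1
    E = q ^ (m ∸ ℓ) ∸ 1

  fullRankCount-positive : ∀ {q} → 1 < q → ∀ {ℓ m} → ℓ ≤ m → 0 < fullRankCount q ℓ m
  fullRankCount-positive 1<q {zero}  ℓ≤m = s≤s z≤n
  fullRankCount-positive 1<q {suc ℓ} ℓ≤m =
    *-mono-≤ (fullRankCount-positive 1<q (<⇒≤ ℓ≤m)) (m<n⇒0<n∸m (^-monoʳ-< _ 1<q ℓ≤m))

  expectation-numerator : ∀ S M R N D E → N * D ≡ R * E →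
    S * (M * (R + (M ∸ 1) * N)) * D ≡ R * S * M * (D + (M ∸ 1) * E)
  expectation-numerator S M R N D E ND≡RE = begin
    S * (M * (R + M₋ * N)) * D
      ≡⟨ solve 6 (λ s m r n d m₋ → s :* (m :* (r :+ m₋ :* n)) :* d := s :* m :* r :* d :+ s :* m :* m₋ :* (n :* d))
                 refl S M R N D M₋ ⟩
    S * M * R * D + S * M * M₋ * (N * D)
      ≡⟨ cong (λ x → S * M * R * D + S * M * M₋ * x) ND≡RE ⟩
    S * M * R * D + S * M * M₋ * (R * E)
      ≡⟨ solve 6 (λ s m r d e m₋ → s :* m :* r :* d :+ s :* m :* m₋ :* (r :* e) := r :* s :* m :* (d :+ m₋ :* e))
                 refl S M R D E M₋ ⟩
    R * S * M * (D + M₋ * E) ∎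
    where
    open ≡-Reasoning
    M₋ : ℕ
    M₋ = M ∸ 1

  X/P≡1+K/D : ∀ X P D K → 0 < P → 0 < D → X * D ≡ P * (D + K) → (ℤ.+ X) // P ≡ 1ℚ ℚ.+ (ℤ.+ K) // D
  X/P≡1+K/D X (suc p) (suc d) K _ _ XD≡P[D+K] = ℚ.toℚᵘ-injective equivalent
    where
    cross-multiplied : ℤ.+ X ℤ.* ℤ.+ (1 * suc d) ≡ (ℤ.+ 1 ℤ.* ℤ.+ suc d ℤ.+ ℤ.+ K ℤ.* ℤ.+ 1) ℤ.* ℤ.+ suc p
    cross-multiplied = begin
      ℤ.+ X ℤ.* ℤ.+ (1 * suc d)
        ≡⟨ cong (λ n → ℤ.+ X ℤ.* ℤ.+ n) (*-identityˡ (suc d)) ⟩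
      ℤ.+ X ℤ.* ℤ.+ suc d
        ≡⟨ ℤ.pos-* X (suc d) ⟨
      ℤ.+ (X * suc d)
        ≡⟨ cong ℤ.+_ (trans XD≡P[D+K] (*-comm (suc p) (suc d + K))) ⟩
      ℤ.+ ((suc d + K) * suc p)
        ≡⟨ ℤ.pos-* (suc d + K) (suc p) ⟩
      ℤ.+ (suc d + K) ℤ.* ℤ.+ suc p
        ≡⟨ cong (ℤ._* ℤ.+ suc p) (ℤ.pos-+ (suc d) K) ⟩
      (ℤ.+ suc d ℤ.+ ℤ.+ K) ℤ.* ℤ.+ suc p
        ≡⟨ cong (ℤ._* ℤ.+ suc p) (cong₂ ℤ._+_ (ℤ.*-identityˡ (ℤ.+ suc d)) (ℤ.*-identityʳ (ℤ.+ K))) ⟨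
      (ℤ.+ 1 ℤ.* ℤ.+ suc d ℤ.+ ℤ.+ K ℤ.* ℤ.+ 1) ℤ.* ℤ.+ suc p ∎
      where open ≡-Reasoning
    equivalent : toℚᵘ (fromℚᵘ (mkℚᵘ (ℤ.+ X) p)) ℚᵘ.≃ toℚᵘ (1ℚ ℚ.+ fromℚᵘ (mkℚᵘ (ℤ.+ K) d))
    equivalent = begin
      toℚᵘ (fromℚᵘ (mkℚᵘ (ℤ.+ X) p))
        ≈⟨ ℚ.toℚᵘ-fromℚᵘ (mkℚᵘ (ℤ.+ X) p) ⟩
      mkℚᵘ (ℤ.+ X) p
        ≈⟨ *≡* cross-multiplied ⟩
      toℚᵘ 1ℚ ℚᵘ.+ mkℚᵘ (ℤ.+ K) d
        ≈⟨ ℚᵘ.+-congʳ (toℚᵘ 1ℚ) (ℚ.toℚᵘ-fromℚᵘ (mkℚᵘ (ℤ.+ K) d)) ⟨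
      toℚᵘ 1ℚ ℚᵘ.+ toℚᵘ (fromℚᵘ (mkℚᵘ (ℤ.+ K) d))
        ≈⟨ ℚ.toℚᵘ-homo-+ 1ℚ (fromℚᵘ (mkℚᵘ (ℤ.+ K) d)) ⟨
      toℚᵘ (1ℚ ℚ.+ fromℚᵘ (mkℚᵘ (ℤ.+ K) d)) ∎
      where open ℚᵘ.≃-Reasoning

-- Linear algebra over F

module LinearAlgebra {q : ℕ} (F : FiniteField q) where

  open FiniteField F renaming (_+_ to infixl 6 _+_; _*_ to infixl 7 _*_; -_ to infix 8 -_)

  ring : CommutativeRing 0ℓ 0ℓ
  ring = record { isCommutativeRing = isCommutativeRing }

  open CommutativeRing ring
    using (*-comm; *-assoc; +-identityˡ; +-identityʳ; *-identityˡ; *-identityʳ;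
           zeroˡ; zeroʳ; distribʳ; -‿inverseˡ; -‿inverseʳ)
  open import Algebra.Properties.Ring (CommutativeRing.ring ring)
    using (-‿distribˡ-*; -‿distribʳ-*; x∙y⁻¹≈ε⇒x≈y; x≈y⇒x∙y⁻¹≈ε; +-inverseˡ-unique; +-inverseʳ-unique)
  open import Algebra.Properties.Semiring.Sum (CommutativeRing.semiring ring)
    using (sum; sum-syntax; sum-cong-≗; sum-replicate-zero; ∑-distrib-+; ∑-comm; sum-remove;
           *-distribˡ-sum; *-distribʳ-sum)

  inv : ∀ x → x ≢ 0# → Fin q
  inv x x≢0 = proj₁ (inverse x x≢0)

  inv-inverseˡ : ∀ x (x≢0 : x ≢ 0#) → inv x x≢0 * x ≡ 1#
  inv-inverseˡ x x≢0 = trans (*-comm _ x) (proj₂ (inverse x x≢0))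

  nonzero-cancelʳ : ∀ {x y} → y ≢ 0# → x * y ≡ 0# → x ≡ 0#
  nonzero-cancelʳ {x} {y} y≢0 xy≡0 = begin
    x                    ≡⟨ *-identityʳ x ⟨
    x * 1#               ≡⟨ cong (x *_) (trans (*-comm y _) (inv-inverseˡ y y≢0)) ⟨
    x * (y * inv y y≢0)  ≡⟨ *-assoc x y _ ⟨
    x * y * inv y y≢0    ≡⟨ cong (_* inv y y≢0) xy≡0 ⟩
    0# * inv y y≢0       ≡⟨ zeroˡ _ ⟩
    0#                   ∎
    where open ≡-Reasoning

  solve-linear : ∀ {a x y} (a≢0 : a ≢ 0#) → x * a + y ≡ 0# ⇔ x ≡ - inv a a≢0 * y
  solve-linear {a} {x} {y} a≢0 = mk⇔ solution satisfies
    where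
    open ≡-Reasoning
    a⁻¹ : Fin q
    a⁻¹ = inv a a≢0
    solution : x * a + y ≡ 0# → x ≡ - a⁻¹ * y
    solution eq = begin
      x                   ≡⟨ *-identityʳ x ⟨
      x * 1#              ≡⟨ cong (x *_) (trans (*-comm a a⁻¹) (inv-inverseˡ a a≢0)) ⟨
      x * (a * a⁻¹)       ≡⟨ *-assoc x a a⁻¹ ⟨
      x * a * a⁻¹         ≡⟨ cong (_* a⁻¹) (+-inverseˡ-unique (x * a) y eq) ⟩
      - y * a⁻¹           ≡⟨ *-comm (- y) a⁻¹ ⟩
      a⁻¹ * - y           ≡⟨ -‿distribʳ-* a⁻¹ y ⟨
      - (a⁻¹ * y)         ≡⟨ -‿distribˡ-* a⁻¹ y ⟩
      - a⁻¹ * y           ∎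
    satisfies : x ≡ - a⁻¹ * y → x * a + y ≡ 0#
    satisfies refl = begin
      - a⁻¹ * y * a + y   ≡⟨ cong (λ z → z * a + y) (-‿distribˡ-* a⁻¹ y) ⟨
      - (a⁻¹ * y) * a + y ≡⟨ cong (_+ y) (-‿distribˡ-* (a⁻¹ * y) a) ⟨
      - (a⁻¹ * y * a) + y ≡⟨ cong (λ z → - z + y) (trans (*-assoc a⁻¹ y a) (cong (a⁻¹ *_) (*-comm y a))) ⟩
      - (a⁻¹ * (a * y)) + y ≡⟨ cong (λ z → - z + y) (*-assoc a⁻¹ a y) ⟨
      - (a⁻¹ * a * y) + y ≡⟨ cong (λ z → - (z * y) + y) (inv-inverseˡ a a≢0) ⟩
      - (1# * y) + y      ≡⟨ cong (λ z → - z + y) (*-identityˡ y) ⟩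
      - y + y             ≡⟨ -‿inverseˡ y ⟩
      0#                  ∎

  ∑≡sum : ∀ n (f : Fin n → Fin q) → ∑ F n f ≡ sum f
  ∑≡sum zero    f = refl
  ∑≡sum (suc n) f = cong (f zero +_) (∑≡sum n (f ∘ suc))

  sum-zero : ∀ {n} {f : Fin n → Fin q} → (∀ i → f i ≡ 0#) → sum f ≡ 0#
  sum-zero {n} f≗0 = trans (sum-cong-≗ f≗0) (sum-replicate-zero n)

  sum-neg : ∀ {n} (f : Fin n → Fin q) → ∑[ i < n ] (- f i) ≡ - sum f
  sum-neg f = +-inverseʳ-unique (sum f) _ (begin
    sum f + ∑[ i < _ ] (- f i)  ≡⟨ ∑-distrib-+ f (λ i → - f i) ⟨
    ∑[ i < _ ] (f i + - f i)    ≡⟨ sum-zero (λ i → -‿inverseʳ (f i)) ⟩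
    0#                          ∎)
    where open ≡-Reasoning

  Vectors : ℕ → DecSetoid 0ℓ 0ℓ
  Vectors = pointwise (≡-decSetoid q)

  Matrices : ℕ → ℕ → DecSetoid 0ℓ 0ℓ
  Matrices ℓ m = pointwise (Vectors m) ℓ

  _≋?_ : ∀ {n} (u v : Vector (Fin q) n) → Dec (∀ j → u j ≡ v j)
  _≋?_ {n} = DecSetoid._≟_ (Vectors n)

  allVecs-enumerates : ∀ n → Enumerates (Vectors n) (allVecs F n)
  allVecs-enumerates n = allFuns-enumerates n (allFin-enumerates q)

  allMats-enumerates : ∀ ℓ m → Enumerates (Matrices ℓ m) (allMats F ℓ m)
  allMats-enumerates ℓ m = allFuns-enumerates ℓ (allVecs-enumerates m)

  length-allVecs : ∀ n → length (allVecs F n) ≡ q ^ n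
  length-allVecs n = trans (length-allFuns n (allFin q)) (cong (_^ n) (length-tabulate id))

  rowComb : ∀ {ℓ m} → Vector (Fin q) ℓ → Mat F ℓ m → Vector (Fin q) m
  rowComb {ℓ} c A j = ∑[ i < ℓ ] (c i * A i j)

  _*ᵛ_ : ∀ {ℓ m} → Mat F ℓ m → Vector (Fin q) m → Vector (Fin q) ℓ
  _*ᵛ_ {m = m} A v i = ∑[ j < m ] (A i j * v j)

  IndependentRows : ∀ {ℓ m} → Mat F ℓ m → Set
  IndependentRows A = ∀ c → (∀ j → rowComb c A j ≡ 0#) → ∀ i → c i ≡ 0#

  T-isZeroVecᵇ : ∀ {n} (v : Vector (Fin q) n) → T (isZeroVecᵇ F v) ⇔ (∀ i → v i ≡ 0#)
  T-isZeroVecᵇ v = ⇔-trans (T-allᵇ-allFin _) (∀-⇔ λ i → T-⌊⌋ (v i ≟ 0#))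

  isZeroVecᵇ-cong : ∀ {n} {u w : Vector (Fin q) n} → (∀ i → u i ≡ w i) → isZeroVecᵇ F u ≡ isZeroVecᵇ F w
  isZeroVecᵇ-cong {u = u} {w} u≗w = T-injective (⇔-trans (T-isZeroVecᵇ u) (⇔-trans
    (∀-⇔ λ i → mk⇔ (trans (sym (u≗w i))) (trans (u≗w i))) (⇔-sym (T-isZeroVecᵇ w))))

  rowComb-cong : ∀ {ℓ m} {c d : Vector (Fin q) ℓ} (A : Mat F ℓ m) → (∀ i → c i ≡ d i) →
    ∀ j → rowComb c A j ≡ rowComb d A j
  rowComb-cong A c≗d j = sum-cong-≗ (λ i → cong (_* A _ j) (c≗d i))

  T-fullRowRankᵇ : ∀ {ℓ m} (A : Mat F ℓ m) → T (fullRowRankᵇ F A) ⇔ IndependentRows A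
  T-fullRowRankᵇ {ℓ} A = ⇔-trans (allᵇ-enumeration (allVecs-enumerates ℓ) test test-resp) (∀-⇔ test⇔)
    where
    test : Vector (Fin q) ℓ → Bool
    test c = not (isZeroVecᵇ F (λ j → ∑ F ℓ (λ i → c i * A i j))) ∨ isZeroVecᵇ F c
    test⇔ : ∀ c → T (test c) ⇔ ((∀ j → rowComb c A j ≡ 0#) → ∀ i → c i ≡ 0#)
    test⇔ c = ⇔-trans (T-→ _ _) (→-cong-⇔
      (⇔-trans (T-isZeroVecᵇ _) (∀-⇔ λ j → mk⇔ (trans (sym (∑≡sum ℓ _))) (trans (∑≡sum ℓ _))))
      (T-isZeroVecᵇ c))
    test-resp : test Preserves DecSetoid._≈_ (Vectors ℓ) ⟶ _≡_
    test-resp = preserves-via (Vectors ℓ) test _ test⇔ λ c≗d implies d-comb≡0 i →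
      trans (sym (c≗d i)) (implies (λ j → trans (rowComb-cong A c≗d j) (d-comb≡0 j)) i)

  rowComb-sub : ∀ {ℓ m} (c d : Vector (Fin q) ℓ) (A : Mat F ℓ m) j →
    rowComb (λ i → c i + - d i) A j ≡ rowComb c A j + - rowComb d A j
  rowComb-sub {ℓ} c d A j = begin
    ∑[ i < ℓ ] ((c i + - d i) * A i j)
      ≡⟨ sum-cong-≗ (λ i → distribʳ (A i j) (c i) (- d i)) ⟩
    ∑[ i < ℓ ] (c i * A i j + - d i * A i j)
      ≡⟨ ∑-distrib-+ (λ i → c i * A i j) (λ i → - d i * A i j) ⟩
    rowComb c A j + ∑[ i < ℓ ] (- d i * A i j)
      ≡⟨ cong (rowComb c A j +_) (sum-cong-≗ (λ i → -‿distribˡ-* (d i) (A i j))) ⟨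
    rowComb c A j + ∑[ i < ℓ ] (- (d i * A i j))
      ≡⟨ cong (rowComb c A j +_) (sum-neg (λ i → d i * A i j)) ⟩
    rowComb c A j + - rowComb d A j          ∎
    where open ≡-Reasoning

  rowComb-scale : ∀ {ℓ m} a (c : Vector (Fin q) ℓ) (A : Mat F ℓ m) j →
    rowComb (λ i → a * c i) A j ≡ a * rowComb c A j
  rowComb-scale a c A j =
    trans (sum-cong-≗ (λ i → *-assoc a (c i) (A i j))) (sym (*-distribˡ-sum a (λ i → c i * A i j)))

  module _ {ℓ m : ℕ} (A : Mat F ℓ m) where

    InSpan : Vector (Fin q) m → Vector (Fin q) ℓ → Set
    InSpan r c = ∀ j → r j ≡ rowComb c A j

    independent-tail : ∀ r → IndependentRows (r V.∷ A) → IndependentRows A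
    independent-tail r indep c comb≡0 i = indep (0# V.∷ c) (λ j → begin
      0# * r j + rowComb c A j ≡⟨ cong (_+ rowComb c A j) (zeroˡ (r j)) ⟩
      0# + rowComb c A j       ≡⟨ +-identityˡ _ ⟩
      rowComb c A j            ≡⟨ comb≡0 j ⟩
      0#                       ∎) (suc i)
      where open ≡-Reasoning

    span-unique : IndependentRows A → ∀ {r c₀} → InSpan r c₀ → ∀ c → InSpan r c ⇔ (∀ i → c i ≡ c₀ i)
    span-unique indep {r} {c₀} c₀-spans c = mk⇔
      (λ c-spans i → x∙y⁻¹≈ε⇒x≈y _ _ (indep (λ i → c i + - c₀ i)
        (λ j → trans (rowComb-sub c c₀ A j) (x≈y⇒x∙y⁻¹≈ε (trans (sym (c-spans j)) (c₀-spans j)))) i))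
      (λ c≗c₀ j → trans (c₀-spans j) (sym (rowComb-cong A c≗c₀ j)))

    extend-dependent : ∀ {r c₀} → InSpan r c₀ → ¬ IndependentRows (r V.∷ A)
    extend-dependent {r} {c₀} c₀-spans indep = 0≢1 (sym (indep (1# V.∷ λ i → - c₀ i) dependence zero))
      where
      open ≡-Reasoning
      dependence : ∀ j → 1# * r j + rowComb (λ i → - c₀ i) A j ≡ 0#
      dependence j = begin
        1# * r j + rowComb (λ i → - c₀ i) A j   ≡⟨ cong (_+ rowComb (λ i → - c₀ i) A j) (*-identityˡ (r j)) ⟩
        r j + rowComb (λ i → - c₀ i) A j        ≡⟨ cong (r j +_) (sum-cong-≗ (λ i → -‿distribˡ-* (c₀ i) (A i j))) ⟨
        r j + ∑[ i < ℓ ] (- (c₀ i * A i j))     ≡⟨ cong (r j +_) (sum-neg (λ i → c₀ i * A i j)) ⟩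
        r j + - rowComb c₀ A j                  ≡⟨ x≈y⇒x∙y⁻¹≈ε (c₀-spans j) ⟩
        0#                                      ∎

    extend-independent : IndependentRows A → ∀ {r} → (∀ c → ¬ InSpan r c) → IndependentRows (r V.∷ A)
    extend-independent indep {r} outside c comb≡0 with c zero ≟ 0#
    ... | yes c₀≡0 = λ { zero → c₀≡0 ; (suc i) → indep (c ∘ suc) tail-comb≡0 i }
      where
      tail-comb≡0 : ∀ j → rowComb (c ∘ suc) A j ≡ 0#
      tail-comb≡0 j = trans (sym (+-identityˡ _))
        (trans (cong (_+ rowComb (c ∘ suc) A j) (sym (trans (cong (_* r j) c₀≡0) (zeroˡ (r j))))) (comb≡0 j))
    ... | no c₀≢0 = ⊥-elim (outside (λ i → - inv (c zero) c₀≢0 * c (suc i)) spans)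
      where
      spans : InSpan r (λ i → - inv (c zero) c₀≢0 * c (suc i))
      spans j = trans (Equivalence.to (solve-linear c₀≢0)
                        (trans (cong (_+ rowComb (c ∘ suc) A j) (*-comm (r j) (c zero))) (comb≡0 j)))
                      (sym (rowComb-scale _ (c ∘ suc) A j))

    spanCount : Vector (Fin q) m → ℕ
    spanCount r = Σ[ c ← allVecs F ℓ ] [ ⌊ r ≋? rowComb c A ⌋ ]

    Σ-spanCount : Σ (allVecs F m) spanCount ≡ q ^ ℓ
    Σ-spanCount = begin
      Σ[ r ← allVecs F m ] Σ[ c ← allVecs F ℓ ] [ ⌊ r ≋? rowComb c A ⌋ ]
        ≡⟨ Σ-swap (allVecs F m) (allVecs F ℓ) _ ⟩
      Σ[ c ← allVecs F ℓ ] Σ[ r ← allVecs F m ] [ ⌊ r ≋? rowComb c A ⌋ ]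
        ≡⟨ Σ-cong (allVecs F ℓ) (λ c → occurs-once (allVecs-enumerates m) (rowComb c A)) ⟩
      Σ (allVecs F ℓ) (const 1)
        ≡⟨ trans (sym (length≡Σ1 (allVecs F ℓ))) (length-allVecs ℓ) ⟩
      q ^ ℓ ∎
      where open ≡-Reasoning

    spans?-resp : ∀ r → (λ c → ⌊ r ≋? rowComb c A ⌋) Preserves DecSetoid._≈_ (Vectors ℓ) ⟶ _≡_
    spans?-resp r c≗d = ⌊⌋-⇔ (mk⇔ (λ c-spans j → trans (c-spans j) (rowComb-cong A c≗d j))
                                  (λ d-spans j → trans (d-spans j) (sym (rowComb-cong A c≗d j))))
                             (r ≋? rowComb _ A) (r ≋? rowComb _ A)

    spanCount-positive : ∀ {r c} → InSpan r c → 0 < spanCount r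
    spanCount-positive {r} {c} c-spans = Σ-positive (allVecs-enumerates ℓ) (λ c → ⌊ r ≋? rowComb c A ⌋)
                                           (spans?-resp r) c (Equivalence.from (T-⌊⌋ (r ≋? rowComb c A)) c-spans)

    spanCount-witness : ∀ {r} → 0 < spanCount r → ∃ (InSpan r)
    spanCount-witness {r} positive = let c₀ , t = satisfied (Σ-positive⇒Any (allVecs F ℓ) _ positive) in
      c₀ , Equivalence.to (T-⌊⌋ (r ≋? rowComb c₀ A)) t

    spanCount-unique : IndependentRows A → ∀ {r c₀} → InSpan r c₀ → spanCount r ≡ 1
    spanCount-unique indep {r} {c₀} c₀-spans = trans
      (Σ-cong (allVecs F ℓ) (λ c → cong [_] (⌊⌋-⇔ (span-unique indep c₀-spans c) (r ≋? rowComb c A) (c ≋? c₀))))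
      (occurs-once (allVecs-enumerates ℓ) c₀)

    fullRowRankᵇ-∷+spanCount≡1 : IndependentRows A → ∀ r →
      [ fullRowRankᵇ F (r V.∷ A) ] ℕ.+ spanCount r ≡ 1
    fullRowRankᵇ-∷+spanCount≡1 indep r with 0 ℕ.<? spanCount r
    ... | yes positive = let c₀ , c₀-spans = spanCount-witness positive in
      cong₂ ℕ._+_ ([]≡0 (extend-dependent c₀-spans ∘ Equivalence.to (T-fullRowRankᵇ (r V.∷ A))))
                  (spanCount-unique indep c₀-spans)
    ... | no ¬positive =
      cong₂ ℕ._+_ ([]≡1 (Equivalence.from (T-fullRowRankᵇ (r V.∷ A))
                           (extend-independent indep λ c → ¬positive ∘ spanCount-positive)))
                  (ℕ.n≤0⇒n≡0 (ℕ.≮⇒≥ ¬positive))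

    count-extensions : IndependentRows A → Σ[ r ← allVecs F m ] [ fullRowRankᵇ F (r V.∷ A) ] ≡ q ^ m ∸ q ^ ℓ
    count-extensions indep = begin
      E
        ≡⟨ ℕ.m+n∸n≡m E (q ^ ℓ) ⟨
      E ℕ.+ q ^ ℓ ∸ q ^ ℓ
        ≡⟨ cong (λ s → E ℕ.+ s ∸ q ^ ℓ) Σ-spanCount ⟨
      E ℕ.+ Σ (allVecs F m) spanCount ∸ q ^ ℓ
        ≡⟨ cong (_∸ q ^ ℓ) (Σ-+ (allVecs F m) _ spanCount) ⟨
      Σ[ r ← allVecs F m ] ([ fullRowRankᵇ F (r V.∷ A) ] ℕ.+ spanCount r) ∸ q ^ ℓ
        ≡⟨ cong (_∸ q ^ ℓ) (Σ-cong (allVecs F m) (fullRowRankᵇ-∷+spanCount≡1 indep)) ⟩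
      Σ (allVecs F m) (const 1) ∸ q ^ ℓ
        ≡⟨ cong (_∸ q ^ ℓ) (trans (sym (length≡Σ1 (allVecs F m))) (length-allVecs m)) ⟩
      q ^ m ∸ q ^ ℓ                              ∎
      where
      open ≡-Reasoning
      E : ℕ
      E = Σ[ r ← allVecs F m ] [ fullRowRankᵇ F (r V.∷ A) ]

  independentRows-resp : ∀ {ℓ m} {A B : Mat F ℓ m} → (∀ i j → A i j ≡ B i j) →
    IndependentRows A → IndependentRows B
  independentRows-resp A≈B indep c comb≡0 =
    indep c (λ j → trans (sum-cong-≗ (λ i → cong (c i *_) (A≈B i j))) (comb≡0 j))

  fullRowRankᵇ-resp : ∀ {ℓ m} → fullRowRankᵇ F Preserves DecSetoid._≈_ (Matrices ℓ m) ⟶ _≡_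
  fullRowRankᵇ-resp = preserves-via (Matrices _ _) (fullRowRankᵇ F) IndependentRows T-fullRowRankᵇ independentRows-resp

  length-RankFull : ∀ ℓ m → length (RankFull F ℓ m) ≡ fullRankCount q ℓ m
  length-RankFull zero m = trans (length-filterᵇ (allMats F 0 m) (fullRowRankᵇ F))
    (cong (ℕ._+ 0) ([]≡1 (Equivalence.from (T-fullRowRankᵇ {0} {m} (λ ())) (λ c _ ()))))
  length-RankFull (suc ℓ) m = begin
    length (RankFull F (suc ℓ) m)
      ≡⟨ length-filterᵇ (allMats F (suc ℓ) m) (fullRowRankᵇ F) ⟩
    Σ[ A ← allMats F (suc ℓ) m ] [ fullRowRankᵇ F A ]
      ≡⟨ Σ-allFuns (allVecs F m) _ (λ A≗B → cong [_] (fullRowRankᵇ-resp (λ i j → cong (_$ j) (A≗B i)))) ⟩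
    Σ[ r ← allVecs F m ] Σ[ A ← allMats F ℓ m ] [ fullRowRankᵇ F (r V.∷ A) ]
      ≡⟨ Σ-swap (allVecs F m) (allMats F ℓ m) _ ⟩
    Σ[ A ← allMats F ℓ m ] Σ[ r ← allVecs F m ] [ fullRowRankᵇ F (r V.∷ A) ]
      ≡⟨ Σ-cong (allMats F ℓ m) extensions ⟩
    Σ[ A ← allMats F ℓ m ] ([ fullRowRankᵇ F A ] ℕ.* (q ^ m ∸ q ^ ℓ))
      ≡⟨ Σ-*ʳ (allMats F ℓ m) (q ^ m ∸ q ^ ℓ) _ ⟩
    Σ[ A ← allMats F ℓ m ] [ fullRowRankᵇ F A ] ℕ.* (q ^ m ∸ q ^ ℓ)
      ≡⟨ cong (ℕ._* (q ^ m ∸ q ^ ℓ))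
              (trans (sym (length-filterᵇ (allMats F ℓ m) (fullRowRankᵇ F))) (length-RankFull ℓ m)) ⟩
    fullRankCount q ℓ m ℕ.* (q ^ m ∸ q ^ ℓ) ∎
    where
    open ≡-Reasoning
    extensions : ∀ A →
      Σ[ r ← allVecs F m ] [ fullRowRankᵇ F (r V.∷ A) ] ≡ [ fullRowRankᵇ F A ] ℕ.* (q ^ m ∸ q ^ ℓ)
    extensions A with fullRowRankᵇ F A in fr≡
    ... | true  = trans (count-extensions A (Equivalence.to (T-fullRowRankᵇ A) (subst T (sym fr≡) _)))
                        (sym (ℕ.+-identityʳ _))
    ... | false = Σ-zero (allVecs F m) (λ r → []≡0 λ t → subst T fr≡ (Equivalence.from (T-fullRowRankᵇ A)
                    (independent-tail A r (Equivalence.to (T-fullRowRankᵇ (r V.∷ A)) t))))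

  RankFull-nonempty : 1 < q → ∀ {ℓ m} → ℓ ≤ m → 0 < length (RankFull F ℓ m)
  RankFull-nonempty 1<q {ℓ} {m} ℓ≤m = subst (0 <_) (sym (length-RankFull ℓ m)) (fullRankCount-positive 1<q ℓ≤m)

  length-RankFull-ratio : ∀ {ℓ m} → ℓ ≤ m →
    length (RankFull F (suc ℓ) m) ℕ.* (q ^ suc m ∸ 1)
      ≡ length (RankFull F (suc ℓ) (suc m)) ℕ.* (q ^ (m ∸ ℓ) ∸ 1)
  length-RankFull-ratio {ℓ} {m} ℓ≤m = begin
    length (RankFull F (suc ℓ) m) ℕ.* (q ^ suc m ∸ 1)
      ≡⟨ cong (ℕ._* (q ^ suc m ∸ 1)) (length-RankFull (suc ℓ) m) ⟩
    fullRankCount q (suc ℓ) m ℕ.* (q ^ suc m ∸ 1)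
      ≡⟨ fullRankCount-ratio q ℓ≤m ⟩
    fullRankCount q (suc ℓ) (suc m) ℕ.* (q ^ (m ∸ ℓ) ∸ 1)
      ≡⟨ cong (ℕ._* (q ^ (m ∸ ℓ) ∸ 1)) (length-RankFull (suc ℓ) (suc m)) ⟨
    length (RankFull F (suc ℓ) (suc m)) ℕ.* (q ^ (m ∸ ℓ) ∸ 1)      ∎
    where open ≡-Reasoning

  rowComb-*ᵛ : ∀ {ℓ m} (c : Vector (Fin q) ℓ) (A : Mat F ℓ m) (v : Vector (Fin q) m) →
    ∑[ i < ℓ ] (c i * (A *ᵛ v) i) ≡ ∑[ j < m ] (rowComb c A j * v j)
  rowComb-*ᵛ {ℓ} {m} c A v = begin
    ∑[ i < ℓ ] (c i * ∑[ j < m ] (A i j * v j))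
      ≡⟨ sum-cong-≗ (λ i → *-distribˡ-sum (c i) (λ j → A i j * v j)) ⟩
    ∑[ i < ℓ ] ∑[ j < m ] (c i * (A i j * v j))
      ≡⟨ ∑-comm (λ i j → c i * (A i j * v j)) ⟩
    ∑[ j < m ] ∑[ i < ℓ ] (c i * (A i j * v j))
      ≡⟨ sum-cong-≗ (λ j → sum-cong-≗ (λ i → *-assoc (c i) (A i j) (v j))) ⟨
    ∑[ j < m ] ∑[ i < ℓ ] (c i * A i j * v j)
      ≡⟨ sum-cong-≗ (λ j → *-distribʳ-sum (v j) (λ i → c i * A i j)) ⟨
    ∑[ j < m ] (rowComb c A j * v j)                 ∎
    where open ≡-Reasoning

  punchIn-cases : ∀ {n} (k : Fin (suc n)) {P : Fin (suc n) → Set} →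
    P k → (∀ j → P (punchIn k j)) → ∀ j → P j
  punchIn-cases k {P} Pk P-punchIn j with k ≟ j
  ... | yes refl = Pk
  ... | no k≢j   = subst P (punchIn-punchOut k≢j) (P-punchIn (punchOut k≢j))

  module _ {ℓ m : ℕ} (v : Vector (Fin q) (suc m)) (k : Fin (suc m)) (vₖ≢0 : v k ≢ 0#) where

    private
      v′ : Vector (Fin q) m
      v′ = removeAt v k

    Annihilates : Mat F ℓ (suc m) → Set
    Annihilates A = ∀ i → (A *ᵛ v) i ≡ 0#

    InKernel : Mat F ℓ (suc m) → Bool
    InKernel A = fullRowRankᵇ F A ∧ isZeroVecᵇ F (A *ᵛ v)

    T-InKernel : ∀ A → T (InKernel A) ⇔ (IndependentRows A × Annihilates A)
    T-InKernel A = ⇔-trans T-∧ (T-fullRowRankᵇ A ×-⇔ T-isZeroVecᵇ (A *ᵛ v))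

    deleteColumn : Mat F ℓ (suc m) → Mat F ℓ m
    deleteColumn A i = removeAt (A i) k

    completeColumn : Mat F ℓ m → Mat F ℓ (suc m)
    completeColumn B i = insertAt (B i) k (- inv (v k) vₖ≢0 * (B *ᵛ v′) i)

    *ᵛ-removeAt : ∀ A i → (A *ᵛ v) i ≡ A i k * v k + (deleteColumn A *ᵛ v′) i
    *ᵛ-removeAt A i = sum-remove {i = k} (λ j → A i j * v j)

    completeColumn-cong : ∀ {B B′} → (∀ i j → B i j ≡ B′ i j) →
      ∀ i j → completeColumn B i j ≡ completeColumn B′ i j
    completeColumn-cong {B} {B′} B≈B′ i = punchIn-cases k
      (trans (insertAt-lookup (B i) k _)
        (trans (cong (- inv (v k) vₖ≢0 *_) (sum-cong-≗ (λ j → cong (_* v′ j) (B≈B′ i j))))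
               (sym (insertAt-lookup (B′ i) k _))))
      (λ j → trans (insertAt-punchIn (B i) k _ j) (trans (B≈B′ i j) (sym (insertAt-punchIn (B′ i) k _ j))))

    deleteColumn∘completeColumn : ∀ B i j → deleteColumn (completeColumn B) i j ≡ B i j
    deleteColumn∘completeColumn B i = insertAt-punchIn (B i) k _

    completeColumn∘deleteColumn : ∀ A → Annihilates A → ∀ i j → completeColumn (deleteColumn A) i j ≡ A i j
    completeColumn∘deleteColumn A Av≡0 i = punchIn-cases k
      (trans (insertAt-lookup _ k _)
             (sym (Equivalence.to (solve-linear vₖ≢0) (trans (sym (*ᵛ-removeAt A i)) (Av≡0 i)))))
      (insertAt-punchIn _ k _)

    completeColumn-annihilates : ∀ B → Annihilates (completeColumn B)
    completeColumn-annihilates B i = begin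
      (completeColumn B *ᵛ v) i                                      ≡⟨ *ᵛ-removeAt (completeColumn B) i ⟩
      completeColumn B i k * v k + (deleteColumn (completeColumn B) *ᵛ v′) i
        ≡⟨ cong₂ (λ x y → x * v k + y) (insertAt-lookup (B i) k _)
                 (sum-cong-≗ (λ j → cong (_* v′ j) (deleteColumn∘completeColumn B i j))) ⟩
      - inv (v k) vₖ≢0 * (B *ᵛ v′) i * v k + (B *ᵛ v′) i             ≡⟨ Equivalence.from (solve-linear vₖ≢0) refl ⟩
      0#                                                             ∎
      where open ≡-Reasoning

    completeColumn-independent : ∀ B → IndependentRows B → IndependentRows (completeColumn B)
    completeColumn-independent B indep c comb≡0 = indep c (λ j →
      trans (sum-cong-≗ (λ i → cong (c i *_) (sym (deleteColumn∘completeColumn B i j)))) (comb≡0 (punchIn k j)))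

    -- A combination vanishing off column k also vanishes on it: it is orthogonal to v, and vₖ ≢ 0.
    deleteColumn-independent : ∀ A → IndependentRows A → Annihilates A → IndependentRows (deleteColumn A)
    deleteColumn-independent A indep Av≡0 c comb≡0 = indep c (punchIn-cases k combₖ≡0 comb≡0)
      where
      open ≡-Reasoning
      combₖ≡0 : rowComb c A k ≡ 0#
      combₖ≡0 = nonzero-cancelʳ vₖ≢0 (begin
        rowComb c A k * v k
          ≡⟨ +-identityʳ _ ⟨
        rowComb c A k * v k + 0#
          ≡⟨ cong (rowComb c A k * v k +_) (sum-zero (λ j → trans (cong (_* v′ j) (comb≡0 j)) (zeroˡ _))) ⟨
        rowComb c A k * v k + ∑[ j < m ] (rowComb c A (punchIn k j) * v′ j)
          ≡⟨ sum-remove {i = k} (λ j → rowComb c A j * v j) ⟨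
        ∑[ j < suc m ] (rowComb c A j * v j)
          ≡⟨ rowComb-*ᵛ c A v ⟨
        ∑[ i < ℓ ] (c i * (A *ᵛ v) i)
          ≡⟨ sum-zero (λ i → trans (cong (c i *_) (Av≡0 i)) (zeroʳ (c i))) ⟩
        0#                                                                    ∎)

    kernel-bijection : BijectionOn (Matrices ℓ (suc m)) (Matrices ℓ m) InKernel (fullRowRankᵇ F)
    kernel-bijection = record
      { to        = deleteColumn
      ; from      = completeColumn
      ; to-cong   = λ A≈A′ i j → A≈A′ i (punchIn k j)
      ; from-cong = completeColumn-cong
      ; to-maps   = λ A t → let indep , Av≡0 = Equivalence.to (T-InKernel A) t in
                            Equivalence.from (T-fullRowRankᵇ _) (deleteColumn-independent A indep Av≡0)
      ; from-maps = λ B t → Equivalence.from (T-InKernel (completeColumn B))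
                              ( completeColumn-independent B (Equivalence.to (T-fullRowRankᵇ B) t)
                              , completeColumn-annihilates B )
      ; from∘to   = λ A t → completeColumn∘deleteColumn A (proj₂ (Equivalence.to (T-InKernel A) t))
      ; to∘from   = λ B _ → deleteColumn∘completeColumn B
      }

    count-kernel : Σ[ A ← allMats F ℓ (suc m) ] [ InKernel A ] ≡ length (RankFull F ℓ m)
    count-kernel = trans
      (Σ-bijection (Matrices ℓ (suc m)) (Matrices ℓ m) (allMats-enumerates ℓ (suc m)) (allMats-enumerates ℓ m)
        InKernel (fullRowRankᵇ F) InKernel-resp fullRowRankᵇ-resp kernel-bijection)
      (sym (length-filterᵇ (allMats F ℓ m) (fullRowRankᵇ F)))
      where
      InKernel-resp : InKernel Preserves DecSetoid._≈_ (Matrices ℓ (suc m)) ⟶ _≡_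
      InKernel-resp A≈B = cong₂ _∧_ (fullRowRankᵇ-resp A≈B)
                                    (isZeroVecᵇ-cong (λ i → sum-cong-≗ (λ j → cong (_* v j) (A≈B i j))))

module Solutions {q : ℕ} (F : FiniteField q) where

  open FiniteField F renaming (_+_ to infixl 6 _+_; _*_ to infixl 7 _*_; -_ to infix 8 -_)
  open LinearAlgebra F

  open CommutativeRing ring using (*-assoc; *-identityˡ; +-identityʳ; zeroˡ; distribˡ)
  open import Algebra.Properties.Ring (CommutativeRing.ring ring) using (-‿distribʳ-*; x∙y⁻¹≈ε⇒x≈y; x≈y⇒x∙y⁻¹≈ε)
  open import Algebra.Properties.Semiring.Sum (CommutativeRing.semiring ring)
    using (sum-syntax; sum-cong-≗; ∑-distrib-+; ∑-comm; sum-remove; *-distribˡ-sum; *-distribʳ-sum)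

  permProduct : ∀ {ℓ m} → Mat F ℓ m → (Fin m → Fin m) → Mat F m 1 → Mat F ℓ 1
  permProduct A ρ B = _⊗_ F (_⊗_ F A (permMat F ρ)) B

  permMat-selects : ∀ {m} (ρ : Fin m → Fin m) k (g : Vector (Fin q) m) →
    ∑[ j < m ] (permMat F ρ k j * g j) ≡ g (ρ k)
  permMat-selects {suc m} ρ k g = begin
    ∑[ j < suc m ] (permMat F ρ k j * g j)
      ≡⟨ sum-remove {i = ρ k} (λ j → permMat F ρ k j * g j) ⟩
    permMat F ρ k (ρ k) * g (ρ k) + ∑[ j < m ] (off-diagonal j)
      ≡⟨ cong₂ _+_ (cong (_* g (ρ k)) diagonal) (sum-zero off-diagonal≡0) ⟩
    1# * g (ρ k) + 0#
      ≡⟨ trans (+-identityʳ _) (*-identityˡ _) ⟩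
    g (ρ k)                                                        ∎
    where
    open ≡-Reasoning
    diagonal : permMat F ρ k (ρ k) ≡ 1#
    diagonal = cong (if_then 1# else 0#) (Equivalence.to T-≡ (fromWitness refl))
    off-diagonal : Fin m → Fin q
    off-diagonal j = permMat F ρ k (punchIn (ρ k) j) * g (punchIn (ρ k) j)
    off-diagonal≡0 : ∀ j → off-diagonal j ≡ 0#
    off-diagonal≡0 j = trans (cong (λ b → (if b then 1# else 0#) * g (punchIn (ρ k) j))
                                   (⌊⌋-no (ρ k ≟ punchIn (ρ k) j) (punchInᵢ≢i (ρ k) j ∘ sym)))
                             (zeroˡ _)

  permProduct-entry : ∀ {ℓ m} (A : Mat F ℓ m) ρ (B : Mat F m 1) i →
    permProduct A ρ B i zero ≡ ∑[ k < m ] (A i k * B (ρ k) zero)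
  permProduct-entry {m = m} A ρ B i = begin
    ∑ F m (λ j → ∑ F m (λ k → A i k * permMat F ρ k j) * B j zero)
      ≡⟨ trans (∑≡sum m _) (sum-cong-≗ (λ j → cong (_* B j zero) (∑≡sum m (λ k → A i k * permMat F ρ k j)))) ⟩
    ∑[ j < m ] (∑[ k < m ] (A i k * permMat F ρ k j) * B j zero)
      ≡⟨ sum-cong-≗ (λ j → *-distribʳ-sum (B j zero) (λ k → A i k * permMat F ρ k j)) ⟩
    ∑[ j < m ] ∑[ k < m ] (A i k * permMat F ρ k j * B j zero)
      ≡⟨ ∑-comm (λ j k → A i k * permMat F ρ k j * B j zero) ⟩
    ∑[ k < m ] ∑[ j < m ] (A i k * permMat F ρ k j * B j zero)
      ≡⟨ sum-cong-≗ (λ k → trans (sum-cong-≗ (λ j → *-assoc (A i k) (permMat F ρ k j) (B j zero)))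
                                 (sym (*-distribˡ-sum (A i k) (λ j → permMat F ρ k j * B j zero)))) ⟩
    ∑[ k < m ] (A i k * ∑[ j < m ] (permMat F ρ k j * B j zero))
      ≡⟨ sum-cong-≗ (λ k → cong (A i k *_) (permMat-selects ρ k (λ j → B j zero))) ⟩
    ∑[ k < m ] (A i k * B (ρ k) zero) ∎
    where open ≡-Reasoning

  T-eqMatᵇ : ∀ {ℓ} (X Y : Mat F ℓ 1) → T (eqMatᵇ F X Y) ⇔ (∀ i → X i zero ≡ Y i zero)
  T-eqMatᵇ {ℓ} X Y = ⇔-trans (T-allᵇ-allFin (λ i → allᵇ (λ j → ⌊ X i j ≟ Y i j ⌋) (allFin 1)))
    (∀-⇔ λ i → ⇔-trans (T-allᵇ-allFin (λ j → ⌊ X i j ≟ Y i j ⌋)) (mk⇔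
      (λ t → Equivalence.to (T-⌊⌋ (X i zero ≟ Y i zero)) (t zero))
      (λ { Xi≡Yi zero → Equivalence.from (T-⌊⌋ (X i zero ≟ Y i zero)) Xi≡Yi ; _ (suc ()) })))

  difference : ∀ {m} → Mat F m 1 → (ρ π : Fin m → Fin m) → Vector (Fin q) m
  difference B ρ π j = B (ρ j) zero + - B (π j) zero

  *ᵛ-difference : ∀ {ℓ m} (A : Mat F ℓ m) B ρ π i →
    (A *ᵛ difference B ρ π) i ≡ permProduct A ρ B i zero + - permProduct A π B i zero
  *ᵛ-difference {m = m} A B ρ π i = begin
    ∑[ j < m ] (A i j * (B (ρ j) zero + - B (π j) zero))
      ≡⟨ sum-cong-≗ (λ j → trans (distribˡ (A i j) _ _)
                                 (cong (A i j * B (ρ j) zero +_) (sym (-‿distribʳ-* (A i j) _)))) ⟩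
    ∑[ j < m ] (A i j * B (ρ j) zero + - (A i j * B (π j) zero))
      ≡⟨ ∑-distrib-+ (λ j → A i j * B (ρ j) zero) (λ j → - (A i j * B (π j) zero)) ⟩
    ∑[ j < m ] (A i j * B (ρ j) zero) + ∑[ j < m ] (- (A i j * B (π j) zero))
      ≡⟨ cong₂ _+_ (sym (permProduct-entry A ρ B i))
                   (trans (sum-neg (λ j → A i j * B (π j) zero)) (cong -_ (sym (permProduct-entry A π B i)))) ⟩
    permProduct A ρ B i zero + - permProduct A π B i zero ∎
    where open ≡-Reasoning

  eqMatᵇ≡isZeroVecᵇ : ∀ {ℓ m} (A : Mat F ℓ m) B ρ π →
    eqMatᵇ F (permProduct A ρ B) (permProduct A π B) ≡ isZeroVecᵇ F (A *ᵛ difference B ρ π)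
  eqMatᵇ≡isZeroVecᵇ A B ρ π = T-injective (⇔-trans (T-eqMatᵇ (permProduct A ρ B) (permProduct A π B))
    (⇔-trans (∀-⇔ λ i → mk⇔ (λ eq → trans (*ᵛ-difference A B ρ π i) (x≈y⇒x∙y⁻¹≈ε eq))
                            (λ eq → x∙y⁻¹≈ε⇒x≈y _ _ (trans (sym (*ᵛ-difference A B ρ π i)) eq)))
             (⇔-sym (T-isZeroVecᵇ (A *ᵛ difference B ρ π)))))

  StarColumn : ∀ {m} → Mat F m 1 → Set
  StarColumn {m} B = (∀ i → B i zero ≢ 0#) × Injective _≡_ _≡_ (λ i → B i zero) × ¬ (∀ i → B i zero ≡ 0#)

  T-starColᵇ : ∀ {m} (B : Mat F m 1) → T (starColᵇ F B) ⇔ StarColumn B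
  T-starColᵇ B = ⇔-trans T-∧ (nonzero ×-⇔ ⇔-trans T-∧ (T-allᵇ-injective (λ i → B i zero) ×-⇔ nonzero-vector))
    where
    nonzero : T (allᵇ (λ i → not ⌊ B i zero ≟ 0# ⌋) (allFin _)) ⇔ (∀ i → B i zero ≢ 0#)
    nonzero = ⇔-trans (T-allᵇ-allFin _) (∀-⇔ λ i → ⇔-trans (T-not _) (¬-cong-⇔ (T-⌊⌋ (B i zero ≟ 0#))))
    nonzero-vector : T (not (isZeroVecᵇ F (λ i → B i zero))) ⇔ (¬ (∀ i → B i zero ≡ 0#))
    nonzero-vector = ⇔-trans (T-not _) (¬-cong-⇔ (T-isZeroVecᵇ _))

  starColᵇ-resp : ∀ {m} → starColᵇ F Preserves DecSetoid._≈_ (Matrices m 1) ⟶ _≡_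
  starColᵇ-resp {m} = preserves-via (Matrices m 1) (starColᵇ F) StarColumn T-starColᵇ
    λ B≈C (nonzero , distinct , nonzero-vector) →
        (λ i → nonzero i ∘ trans (B≈C i zero))
      , (λ {i} {j} Ci≡Cj → distinct (trans (B≈C i zero) (trans Ci≡Cj (sym (B≈C j zero)))))
      , (λ C≡0 → nonzero-vector (λ i → trans (B≈C i zero) (C≡0 i)))

  Permutations : ℕ → DecSetoid 0ℓ 0ℓ
  Permutations m = pointwise (≡-decSetoid m) m

  _≗?_ : ∀ {m} (ρ π : Fin m → Fin m) → Dec (∀ k → ρ k ≡ π k)
  _≗?_ {m} = DecSetoid._≟_ (Permutations m)

  solutionCount : ∀ ℓ {m} → Mat F m 1 → (π ρ : Fin m → Fin m) → ℕ
  solutionCount ℓ {m} B π ρ = Σ[ A ← RankFull F ℓ m ] [ eqMatᵇ F (permProduct A ρ B) (permProduct A π B) ]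

  solutionCount-same : ∀ ℓ {m} B (π ρ : Fin m → Fin m) → (∀ k → ρ k ≡ π k) →
    solutionCount ℓ B π ρ ≡ length (RankFull F ℓ m)
  solutionCount-same ℓ {m} B π ρ ρ≗π = trans (Σ-cong (RankFull F ℓ m) solves) (sym (length≡Σ1 (RankFull F ℓ m)))
    where
    solves : ∀ A → [ eqMatᵇ F (permProduct A ρ B) (permProduct A π B) ] ≡ 1
    solves A = []≡1 (Equivalence.from (T-eqMatᵇ (permProduct A ρ B) (permProduct A π B)) λ i →
      trans (permProduct-entry A ρ B i) (trans (sum-cong-≗ (λ k → cong (λ x → A i k * B x zero) (ρ≗π k)))
                                               (sym (permProduct-entry A π B i))))

  solutionCount-different : ∀ ℓ {m} B (π ρ : Fin (suc m) → Fin (suc m)) → StarColumn B → ¬ (∀ k → ρ k ≡ π k) →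
    solutionCount ℓ B π ρ ≡ length (RankFull F ℓ m)
  solutionCount-different ℓ {m} B π ρ (_ , distinct , _) ρ≉π = begin
    Σ[ A ← RankFull F ℓ (suc m) ] [ eqMatᵇ F (permProduct A ρ B) (permProduct A π B) ]
      ≡⟨ Σ-cong (RankFull F ℓ (suc m)) (λ A → cong [_] (eqMatᵇ≡isZeroVecᵇ A B ρ π)) ⟩
    Σ[ A ← RankFull F ℓ (suc m) ] [ isZeroVecᵇ F (A *ᵛ Δ) ]
      ≡⟨ Σ-filterᵇ (allMats F ℓ (suc m)) (fullRowRankᵇ F) _ ⟩
    Σ[ A ← allMats F ℓ (suc m) ] ([ fullRowRankᵇ F A ] ℕ.* [ isZeroVecᵇ F (A *ᵛ Δ) ])
      ≡⟨ Σ-cong (allMats F ℓ (suc m)) (λ A → sym ([∧] (fullRowRankᵇ F A) _)) ⟩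
    Σ[ A ← allMats F ℓ (suc m) ] [ InKernel Δ k Δₖ≢0 A ]
      ≡⟨ count-kernel {ℓ} Δ k Δₖ≢0 ⟩
    length (RankFull F ℓ m) ∎
    where
    open ≡-Reasoning
    Δ : Vector (Fin q) (suc m)
    Δ = difference B ρ π
    k : Fin (suc m)
    k = proj₁ (¬∀⟶∃¬ (suc m) _ (λ k → ρ k ≟ π k) ρ≉π)
    Δₖ≢0 : Δ k ≢ 0#
    Δₖ≢0 Δₖ≡0 = proj₂ (¬∀⟶∃¬ (suc m) _ (λ k → ρ k ≟ π k) ρ≉π) (distinct (x∙y⁻¹≈ε⇒x≈y _ _ Δₖ≡0))

  injectiveᵇ-resp : ∀ {m} → injectiveᵇ Preserves DecSetoid._≈_ (Permutations m) ⟶ _≡_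
  injectiveᵇ-resp = preserves-via (Permutations _) injectiveᵇ (Injective _≡_ _≡_) T-allᵇ-injective injective-resp-≗

  Σ-same-permutation : ∀ {m} (π : Fin m → Fin m) → T (injectiveᵇ π) → Σ[ ρ ← Sym m ] [ ⌊ ρ ≗? π ⌋ ] ≡ 1
  Σ-same-permutation {m} π π-injective = begin
    Σ[ ρ ← Sym m ] [ ⌊ ρ ≗? π ⌋ ]
      ≡⟨ Σ-filterᵇ ρs injectiveᵇ _ ⟩
    Σ[ ρ ← ρs ] ([ injectiveᵇ ρ ] ℕ.* [ ⌊ ρ ≗? π ⌋ ])
      ≡⟨ Σ-cong ρs (λ ρ → ℕ.*-comm [ injectiveᵇ ρ ] _) ⟩
    Σ[ ρ ← ρs ] ([ ⌊ ρ ≗? π ⌋ ] ℕ.* [ injectiveᵇ ρ ])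
      ≡⟨ Σ-pick (allFuns-enumerates m (allFin-enumerates m)) (λ ρ → [ injectiveᵇ ρ ]) (cong [_] ∘ injectiveᵇ-resp) π ⟩
    [ injectiveᵇ π ]
      ≡⟨ []≡1 π-injective ⟩
    1 ∎
    where
    open ≡-Reasoning
    ρs : List (Fin m → Fin m)
    ρs = allFuns m (allFin m)

  Σ-solutionCount : ∀ ℓ {m} B (π : Fin (suc m) → Fin (suc m)) → StarColumn B → T (injectiveᵇ π) →
    Σ (Sym (suc m)) (solutionCount ℓ B π)
      ≡ length (RankFull F ℓ (suc m)) ℕ.+ (length (Sym (suc m)) ∸ 1) ℕ.* length (RankFull F ℓ m)
  Σ-solutionCount ℓ {m} B π B-star π-injective = begin
    Σ (Sym (suc m)) (solutionCount ℓ B π)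
      ≡⟨ Σ-cong (Sym (suc m)) by-cases ⟩
    Σ[ ρ ← Sym (suc m) ] ([ same ρ ] ℕ.* R ℕ.+ [ not (same ρ) ] ℕ.* N)
      ≡⟨ Σ-+ (Sym (suc m)) _ _ ⟩
    Σ[ ρ ← Sym (suc m) ] ([ same ρ ] ℕ.* R) ℕ.+ Σ[ ρ ← Sym (suc m) ] ([ not (same ρ) ] ℕ.* N)
      ≡⟨ cong₂ ℕ._+_ (Σ-*ʳ (Sym (suc m)) R _) (Σ-*ʳ (Sym (suc m)) N _) ⟩
    Σ[ ρ ← Sym (suc m) ] [ same ρ ] ℕ.* R ℕ.+ Σ[ ρ ← Sym (suc m) ] [ not (same ρ) ] ℕ.* N
      ≡⟨ cong₂ (λ a b → a ℕ.* R ℕ.+ b ℕ.* N) one others ⟩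
    1 ℕ.* R ℕ.+ (length (Sym (suc m)) ∸ 1) ℕ.* N
      ≡⟨ cong (ℕ._+ (length (Sym (suc m)) ∸ 1) ℕ.* N) (ℕ.*-identityˡ R) ⟩
    R ℕ.+ (length (Sym (suc m)) ∸ 1) ℕ.* N                ∎
    where
    open ≡-Reasoning
    R N : ℕ
    R = length (RankFull F ℓ (suc m))
    N = length (RankFull F ℓ m)
    same : (Fin (suc m) → Fin (suc m)) → Bool
    same ρ = ⌊ ρ ≗? π ⌋
    by-cases : ∀ ρ → solutionCount ℓ B π ρ ≡ [ same ρ ] ℕ.* R ℕ.+ [ not (same ρ) ] ℕ.* N
    by-cases ρ with ρ ≗? π
    ... | yes ρ≗π = trans (solutionCount-same ℓ B π ρ ρ≗π) (sym (trans (ℕ.+-identityʳ _) (ℕ.+-identityʳ R)))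
    ... | no ρ≉π  = trans (solutionCount-different ℓ B π ρ B-star ρ≉π) (sym (ℕ.+-identityʳ N))
    one : Σ[ ρ ← Sym (suc m) ] [ same ρ ] ≡ 1
    one = Σ-same-permutation π π-injective
    others : Σ[ ρ ← Sym (suc m) ] [ not (same ρ) ] ≡ length (Sym (suc m)) ∸ 1
    others = trans (sym (ℕ.m+n∸m≡n 1 _)) (cong (_∸ 1)
      (trans (cong (ℕ._+ Σ[ ρ ← Sym (suc m) ] [ not (same ρ) ]) (sym one)) (Σ-[]+Σ-[not] (Sym (suc m)) same)))

  totalNsol≡ : ∀ ℓ m → totalNsol F ℓ (suc m) ≡
    length (StarCol F (suc m)) ℕ.* (length (Sym (suc m)) ℕ.*
      (length (RankFull F ℓ (suc m)) ℕ.+ (length (Sym (suc m)) ∸ 1) ℕ.* length (RankFull F ℓ m)))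
  totalNsol≡ ℓ m = begin
    Σ[ A ← As ] Σ[ B ← Bs ] Σ[ π ← πs ] Nsol F A B (permProduct A π B)
      ≡⟨ Σ-cong As (λ A → Σ-cong Bs (λ B → Σ-cong πs (λ π → length-filterᵇ πs _))) ⟩
    Σ[ A ← As ] Σ[ B ← Bs ] Σ[ π ← πs ] Σ[ ρ ← πs ] solves A B π ρ
      ≡⟨ Σ-swap As Bs _ ⟩
    Σ[ B ← Bs ] Σ[ A ← As ] Σ[ π ← πs ] Σ[ ρ ← πs ] solves A B π ρ
      ≡⟨ Σ-cong Bs (λ B → Σ-swap As πs _) ⟩
    Σ[ B ← Bs ] Σ[ π ← πs ] Σ[ A ← As ] Σ[ ρ ← πs ] solves A B π ρ
      ≡⟨ Σ-cong Bs (λ B → Σ-cong πs (λ π → Σ-swap As πs _)) ⟩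
    Σ[ B ← Bs ] Σ[ π ← πs ] Σ (Sym (suc m)) (solutionCount ℓ B π)
      ≡⟨ Σ-filterᵇ-cong (allMats F (suc m) 1) (starColᵇ F) (λ B B-star →
           Σ-filterᵇ-cong (allFuns (suc m) (allFin (suc m))) injectiveᵇ (λ π π-injective →
             Σ-solutionCount ℓ B π (Equivalence.to (T-starColᵇ B) B-star) π-injective)) ⟩
    Σ[ B ← Bs ] Σ[ π ← πs ] K
      ≡⟨ Σ-cong Bs (λ B → Σ-const πs K) ⟩
    Σ[ B ← Bs ] (length πs ℕ.* K)
      ≡⟨ Σ-const Bs _ ⟩
    length Bs ℕ.* (length πs ℕ.* K) ∎
    where
    open ≡-Reasoning
    As : List (Mat F ℓ (suc m))
    As = RankFull F ℓ (suc m)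
    Bs : List (Mat F (suc m) 1)
    Bs = StarCol F (suc m)
    πs : List (Fin (suc m) → Fin (suc m))
    πs = Sym (suc m)
    solves : Mat F ℓ (suc m) → Mat F (suc m) 1 → (π ρ : Fin (suc m) → Fin (suc m)) → ℕ
    solves A B π ρ = [ eqMatᵇ F (permProduct A ρ B) (permProduct A π B) ]
    K : ℕ
    K = length As ℕ.+ (length πs ∸ 1) ℕ.* length (RankFull F ℓ m)

StarCol-nonempty : ∀ {q} (F : FiniteField (suc q)) {m} → 0 ℕ.< m → m ℕ.≤ q → 0 ℕ.< length (StarCol F m)
StarCol-nonempty F {suc m} _ m≤q = subst (0 ℕ.<_) (sym (length-filterᵇ (allMats F (suc m) 1) (starColᵇ F)))
  (Σ-positive (allMats-enumerates (suc m) 1) (starColᵇ F) starColᵇ-resp B₀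
    (Equivalence.from (T-starColᵇ B₀) (nonzero , distinct , λ B₀≡0 → nonzero zero (B₀≡0 zero))))
  where
  open FiniteField F using (0#)
  open LinearAlgebra F
  open Solutions F
  B₀ : Mat F (suc m) 1
  B₀ i _ = punchIn 0# (inject≤ i m≤q)
  nonzero : ∀ i → B₀ i zero ≢ 0#
  nonzero i = punchInᵢ≢i 0# (inject≤ i m≤q)
  distinct : Injective _≡_ _≡_ (λ i → B₀ i zero)
  distinct {i} {j} = inject≤-injective m≤q m≤q i j ∘ punchIn-injective 0# _ _

open import Data.Nat using (_*_)
open import Data.Integer using (+_)
open import Data.Rational using (_+_; 1ℚ)

theorem2 : (q : ℕ) (F : FiniteField q) (ℓ m : ℕ) → 1 ≤ ℓ → ℓ ≤ m → m < q →
    expectedNsol F ℓ m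
    ≡ 1ℚ + ((+ ((m ! ∸ 1) * (q ^ (m ∸ ℓ) ∸ 1))) // (q ^ m ∸ 1))
theorem2 (suc q) F (suc ℓ) (suc m) (s≤s z≤n) (s≤s ℓ≤m) (s≤s m<q) =
  X/P≡1+K/D (totalNsol F (suc ℓ) (suc m)) (R * S * M) D ((suc m ! ∸ 1) * E) denominator>0 D>0 (begin
    totalNsol F (suc ℓ) (suc m) * D
      ≡⟨ cong (_* D) (Solutions.totalNsol≡ F (suc ℓ) m) ⟩
    S * (M * (R ℕ.+ (M ∸ 1) * N)) * D
      ≡⟨ expectation-numerator S M R N D E (LinearAlgebra.length-RankFull-ratio F ℓ≤m) ⟩
    R * S * M * (D ℕ.+ (M ∸ 1) * E)
      ≡⟨ cong (λ k → R * S * M * (D ℕ.+ (k ∸ 1) * E)) (length-Sym (suc m)) ⟩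
    R * S * M * (D ℕ.+ (suc m ! ∸ 1) * E)  ∎)
  where
  open ≡-Reasoning
  R N S M D E : ℕ
  R = length (RankFull F (suc ℓ) (suc m))
  N = length (RankFull F (suc ℓ) m)
  S = length (StarCol F (suc m))
  M = length (Sym (suc m))
  D = suc q ^ suc m ∸ 1
  E = suc q ^ (m ∸ ℓ) ∸ 1
  1<q : 1 < suc q
  1<q = s≤s (ℕ.≤-trans (s≤s z≤n) m<q)
  D>0 : 0 < D
  D>0 = ℕ.m<n⇒0<n∸m (ℕ.^-monoʳ-< (suc q) 1<q {0} {suc m} (s≤s z≤n))
  denominator>0 : 0 < R * S * M
  denominator>0 = ℕ.*-mono-≤ (ℕ.*-mono-≤ (LinearAlgebra.RankFull-nonempty F 1<q (s≤s ℓ≤m))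
                                         (StarCol-nonempty F (s≤s z≤n) m<q))
                             (Sym-nonempty (suc m))
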